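{- Let $\mathfrak{g}$ be a classical simple Lie algebra of rank $r\ge5$ with simple roots $\alpha_1,\dots,\alpha_r$. Let $I=\{i_1,\ldots,i_\ell\}$ be a set of pairwise nonconsecutive integers with $1<i_1<\cdots<i_\ell<r-2$, let $c_{i_1},\ldots,c_{i_\ell}$ be positive integers, and let $\lambda=\sum_{i=1}^r\alpha_i+\sum_{j=1}^\ell c_{i_j}\alpha_{i_j}$. Then the number of ways to write $\lambda$ as a sum of positive roots of $\mathfrak{g}$ is $$\wp(\lambda)=2^{r-1}\left(\tfrac{5}{4}\right)^{\ell}.$$
   Context: Simple roots are labeled in the standard (Bourbaki) way (Dynkin diagram the path $\alpha_1-\cdots-\alpha_r$ in types $A,B,C$; in type $D_r$ the node $\alpha_{r-2}$ is joined to $\alpha_{r-1}$ and $\alpha_r$). Kostant's partition function $\wp(\xi)$ is the number of functions $n:\Phi^+\to\mathbb{Z}_{\ge0}$ on the positive roots with $\sum_{\alpha}n(\alpha)\alpha=\xi$ (i.e. unordered expressions of $\xi$ as a sum of positive roots with repetition allowed). -}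

module Defs where

open import Data.Nat using (ℕ; zero; suc; _+_; _*_; _∸_; _≤ᵇ_; _≡ᵇ_)
open import Data.Bool using (Bool; true; false; if_then_else_; _∧_)
open import Data.List using (List; []; _∷_; _++_; concatMap; map; allFin; upTo)
open import Data.Nat.ListAction using (sum)
open import Data.Vec as Vec using (Vec; tabulate; zipWith; foldr)
open import Data.Fin using (Fin; toℕ)

data ClassicalType : Set where
  A B C D : ClassicalType

-- Elements of the root lattice are written in the basis of simple roots
-- α_1, …, α_r : a vector ξ ∈ ℕ^r stands for Σ_m ξ[m] α_{m+1}
-- (Fin index m corresponds to the simple root α_{m+1}).
Weight : ℕ → Set
Weight r = Vec ℕ r

vec : (r : ℕ) → (ℕ → ℕ) → Weight r
vec r f = tabulate (λ k → f (suc (toℕ k)))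

seg : ℕ → ℕ → ℕ → ℕ
seg i j m = if (i ≤ᵇ m) ∧ (m ≤ᵇ j) then 1 else 0

-- the list a, a+1, …, b  (empty if b < a)
range : ℕ → ℕ → List ℕ
range a b = Data.List.map (a +_) (upTo (suc b ∸ a))

pairsLe : ℕ → (ℕ → ℕ → List (ℕ → ℕ)) → List (ℕ → ℕ)
pairsLe n g = concatMap (λ i → concatMap (λ j → g i j) (range i n)) (range 1 n)

pairsLt : ℕ → (ℕ → ℕ → List (ℕ → ℕ)) → List (ℕ → ℕ)
pairsLt n g = concatMap (λ i → concatMap (λ j → g i j) (range (suc i) n)) (range 1 n)

-- Positive roots (Bourbaki labelling), as coefficient functions on 1..r.
posRootsFn : ClassicalType → ℕ → List (ℕ → ℕ)
posRootsFn A r = pairsLe r (λ i j → seg i j ∷ [])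
-- B_r : α_i + … + α_j (1 ≤ i ≤ j ≤ r)   [e_i - e_j and e_i]
--       α_i + … + α_{j-1} + 2(α_j + … + α_r)  (1 ≤ i < j ≤ r)   [e_i + e_j]
posRootsFn B r =
  pairsLe r (λ i j → seg i j ∷ []) ++
  pairsLt r (λ i j → (λ m → seg i (j ∸ 1) m + 2 * seg j r m) ∷ [])
-- C_r : α_i + … + α_j (1 ≤ i ≤ j ≤ r-1)   [e_i - e_j]
--       α_i + … + α_{j-1} + 2(α_j + … + α_{r-1}) + α_r (1 ≤ i < j ≤ r)   [e_i + e_j]
--       2(α_i + … + α_{r-1}) + α_r  (1 ≤ i ≤ r)   [2 e_i]
posRootsFn C r =
  pairsLe (r ∸ 1) (λ i j → seg i j ∷ []) ++
  pairsLt r (λ i j → (λ m → seg i (j ∸ 1) m + 2 * seg j (r ∸ 1) m + seg r r m) ∷ []) ++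
  Data.List.map (λ i m → 2 * seg i (r ∸ 1) m + seg r r m) (range 1 r)
-- D_r : α_i + … + α_j (1 ≤ i ≤ j ≤ r-1)   [e_i - e_j]
--       α_i + … + α_{r-2} + α_r (1 ≤ i ≤ r-1)   [e_i + e_r]
--       α_i + … + α_{j-1} + 2(α_j + … + α_{r-2}) + α_{r-1} + α_r
--            (1 ≤ i < j ≤ r-1)   [e_i + e_j]
posRootsFn D r =
  pairsLe (r ∸ 1) (λ i j → seg i j ∷ []) ++
  Data.List.map (λ i m → seg i (r ∸ 2) m + seg r r m) (range 1 (r ∸ 1)) ++
  pairsLt (r ∸ 1) (λ i j → (λ m → seg i (j ∸ 1) m + 2 * seg j (r ∸ 2) m
                                 + seg (r ∸ 1) (r ∸ 1) m + seg r r m) ∷ [])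

posRoots : ClassicalType → (r : ℕ) → List (Weight r)
posRoots t r = Data.List.map (vec r) (posRootsFn t r)

_≤ʷ_ : {r : ℕ} → Weight r → Weight r → Bool
u ≤ʷ v = foldr _ _∧_ true (zipWith _≤ᵇ_ u v)

isZero : {r : ℕ} → Weight r → Bool
isZero v = foldr _ _∧_ true (Vec.map (_≡ᵇ 0) v)

height : {r : ℕ} → Weight r → ℕ
height v = foldr _ _+_ 0 v

scale : {r : ℕ} → ℕ → Weight r → Weight r
scale k v = Vec.map (k *_) v

minus : {r : ℕ} → Weight r → Weight r → Weight r
minus = zipWith _∸_

-- Computed by choosing the multiplicity k = n(α) of the first root α
-- (only k ≤ height ξ can occur, as every positive root is nonzero; in
-- general k ranges over all k with k·α ≤ ξ, and the bound height ξ
-- suffices whenever α ≠ 0).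
countReps : {r : ℕ} → List (Weight r) → Weight r → ℕ
countReps [] ξ = if isZero ξ then 1 else 0
countReps (α ∷ Φ) ξ =
  sum (Data.List.map
         (λ k → if scale k α ≤ʷ ξ then countReps Φ (minus ξ (scale k α)) else 0)
         (upTo (suc (height ξ))))

kostant : (t : ClassicalType) (r : ℕ) → Weight r → ℕ
kostant t r ξ = countReps (posRoots t r) ξ

lambdaWeight : (r ℓ : ℕ) → (Fin ℓ → ℕ) → (Fin ℓ → ℕ) → Weight r
lambdaWeight r ℓ i c =
  vec r (λ m → 1 + sum (Data.List.map (λ j → if i j ≡ᵇ m then c j else 0) (allFin ℓ)))

-- Only positive roots whose last three coefficients are at most 1 can occur in a partition of λ.
-- In every classical type these roots form, up to order, a system obtained from a rank-3 system by
-- repeatedly attaching a node to the left of α₁: the roots through the new node are the node itself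
-- and its sums with the roots through the old first node. Sorting the partitions of a weight of such
-- a system by the roots that cover its first node gives ℘(x ∷ 1 ∷ η) = 2 ℘′(1 ∷ η) for x ≥ 1 and
-- ℘(1 ∷ b ∷ 1 ∷ η) = 5 ℘″(1 ∷ η) for b ≥ 2, where ℘′ and ℘″ count in the systems with one and two
-- nodes fewer (α₁, α₁ + α₂ and the longer roots through α₁ contribute 2, 2 and 1). With
-- ℘(1, 1, 1) = 4 on the base, peeling λ from the left yields a factor 2 per node and an extra factor
-- 5/4 per enlarged coefficient.

module Submission where

open import Defs
open import Algebra.Bundles using (CommutativeMonoid)
import Algebra.Properties.CommutativeSemigroup as CommSemigroupProperties
open import Data.Bool using (Bool; true; false; T; if_then_else_; _∧_)
open import Data.Bool.Properties using (∧-identityʳ; ∧-zeroʳ; ∧-commutativeMonoid; T-∧; T-≡)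
open import Data.Empty using (⊥; ⊥-elim)
open import Data.Fin as Fin using (Fin; toℕ)
open import Data.Fin.Properties using (toℕ-injective)
open import Data.List using (List; []; _∷_; _++_; map; upTo; concatMap; filterᵇ; [_]; tabulate; allFin)
open import Data.List.Properties
  using (map-applyUpTo; map-upTo; map-cong; map-∘; map-++; ++-assoc; map-tabulate;
         concatMap-cong; concatMap-map; concatMap-pure; map-concatMap; filter-++; filter-accept; filter-reject)
open import Data.List.Relation.Unary.All as All using (All; []; _∷_; all?)
import Data.List.Relation.Unary.All.Properties as Allₚ
open import Data.List.Relation.Binary.Permutation.Propositional as ↭
  using (_↭_; ↭-refl; ↭-sym; ↭-reflexive; module PermutationReasoning)
open import Data.List.Relation.Binary.Permutation.Propositional.Properties
  using (All-resp-↭; ++⁺; ++⁺ˡ; map⁺; filter-↭; ++-commutativeMonoid)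
open import Data.Nat using (ℕ; zero; suc; _+_; _*_; _∸_; _^_; _≤_; _<_; _≤?_; _≤ᵇ_; _≡ᵇ_; z≤n; s≤s; NonZero; >-nonZero)
open import Data.Nat.ListAction using (sum)
open import Data.Nat.Properties
open import Data.Nat.Tactic.RingSolver using (solve-∀)
open import Data.Product using (_×_; _,_; proj₁; proj₂; ∃-syntax)
open import Data.Sum using (_⊎_; inj₁; inj₂)
open import Data.Vec as Vec using ([]; _∷_; zipWith)
open import Data.Vec.Properties using (zipWith-comm; tabulate-cong)
open import Function using (_∘_; id; Equivalence; case_of_)
open import Relation.Binary using (tri<; tri≈; tri>)
open import Relation.Binary.PropositionalEquality hiding ([_])
open import Relation.Nullary using (¬_)
open import Relation.Nullary.Decidable using (T?; True; toWitness)

open Equivalence using (to; from)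
open CommSemigroupProperties +-commutativeSemigroup using () renaming (interchange to +-interchange)
open CommSemigroupProperties (CommutativeMonoid.commutativeSemigroup ∧-commutativeMonoid)
  using () renaming (interchange to ∧-interchange)

≤ᵇ-suc : ∀ a x → (suc a ≤ᵇ suc x) ≡ (a ≤ᵇ x)
≤ᵇ-suc zero    x = refl
≤ᵇ-suc (suc a) x = refl

≤ᵇ-∸ : ∀ a b x → ((a ≤ᵇ x) ∧ (b ≤ᵇ x ∸ a)) ≡ (a + b ≤ᵇ x)
≤ᵇ-∸ zero    b x       = refl
≤ᵇ-∸ (suc a) b zero    = refl
≤ᵇ-∸ (suc a) b (suc x) rewrite ≤ᵇ-suc a x | ≤ᵇ-suc (a + b) x = ≤ᵇ-∸ a b x

sum< : ℕ → (ℕ → ℕ) → ℕ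
sum< n f = sum (map f (upTo n))

sum<-suc : ∀ n f → sum< (suc n) f ≡ f 0 + sum< n (f ∘ suc)
sum<-suc n f = cong (λ xs → f 0 + sum xs) (trans (map-applyUpTo suc f n) (sym (map-upTo (f ∘ suc) n)))

sum<-cong : ∀ n {f g} → f ≗ g → sum< n f ≡ sum< n g
sum<-cong n f≗g = cong sum (map-cong f≗g (upTo n))

sum<-zero : ∀ n f → (∀ k → f k ≡ 0) → sum< n f ≡ 0
sum<-zero zero    f f≡0 = refl
sum<-zero (suc n) f f≡0 = trans (sum<-suc n f) (cong₂ _+_ (f≡0 0) (sum<-zero n (f ∘ suc) (f≡0 ∘ suc)))

sum<-+ : ∀ n f g → sum< n (λ k → f k + g k) ≡ sum< n f + sum< n g
sum<-+ zero    f g = refl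
sum<-+ (suc n) f g = begin
  sum< (suc n) (λ k → f k + g k)                       ≡⟨ sum<-suc n _ ⟩
  (f 0 + g 0) + sum< n (λ k → f (suc k) + g (suc k))   ≡⟨ cong (f 0 + g 0 +_) (sum<-+ n (f ∘ suc) (g ∘ suc)) ⟩
  (f 0 + g 0) + (sum< n (f ∘ suc) + sum< n (g ∘ suc))  ≡⟨ +-interchange (f 0) (g 0) _ _ ⟩
  (f 0 + sum< n (f ∘ suc)) + (g 0 + sum< n (g ∘ suc))  ≡⟨ sym (cong₂ _+_ (sum<-suc n f) (sum<-suc n g)) ⟩
  sum< (suc n) f + sum< (suc n) g                      ∎
  where open ≡-Reasoning

sum<-swap : ∀ a b (h : ℕ → ℕ → ℕ) → sum< a (λ k → sum< b (h k)) ≡ sum< b (λ m → sum< a (λ k → h k m))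
sum<-swap zero    b h = sym (sum<-zero b _ (λ _ → refl))
sum<-swap (suc a) b h = begin
  sum< (suc a) (λ k → sum< b (h k))                          ≡⟨ sum<-suc a _ ⟩
  sum< b (h 0) + sum< a (λ k → sum< b (h (suc k)))           ≡⟨ cong (sum< b (h 0) +_) (sum<-swap a b (h ∘ suc)) ⟩
  sum< b (h 0) + sum< b (λ m → sum< a (λ k → h (suc k) m))   ≡⟨ sym (sum<-+ b _ _) ⟩
  sum< b (λ m → h 0 m + sum< a (λ k → h (suc k) m))          ≡⟨ sum<-cong b (λ m → sym (sum<-suc a (λ k → h k m))) ⟩
  sum< b (λ m → sum< (suc a) (λ k → h k m))                  ∎
  where open ≡-Reasoning

sum<-extend : ∀ {a b} f → a ≤ b → (∀ k → a ≤ k → f k ≡ 0) → sum< a f ≡ sum< b f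
sum<-extend {zero}  {b}     f _         f≡0 = sym (sum<-zero b f (λ k → f≡0 k z≤n))
sum<-extend {suc a} {suc b} f (s≤s a≤b) f≡0 = begin
  sum< (suc a) f          ≡⟨ sum<-suc a f ⟩
  f 0 + sum< a (f ∘ suc)  ≡⟨ cong (f 0 +_) (sum<-extend (f ∘ suc) a≤b (λ k a≤k → f≡0 (suc k) (s≤s a≤k))) ⟩
  f 0 + sum< b (f ∘ suc)  ≡⟨ sym (sum<-suc b f) ⟩
  sum< (suc b) f          ∎
  where open ≡-Reasoning

sum≤ : ℕ → (ℕ → ℕ) → ℕ
sum≤ zero    g = g 0
sum≤ (suc x) g = g (suc x) + sum≤ x g

sum<-countdown : ∀ x N g → x ≤ N → sum< (suc N) (λ k → if k ≤ᵇ x then g (x ∸ k) else 0) ≡ sum≤ x g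
sum<-countdown zero    N       g _ =
  trans (sym (sum<-extend {b = suc N} _ (s≤s z≤n) (λ { (suc k) _ → refl }))) (+-identityʳ (g 0))
sum<-countdown (suc x) (suc N) g (s≤s x≤N) =
  trans (sum<-suc (suc N) F) (cong (g (suc x) +_) (trans (sum<-cong (suc N) F-suc) (sum<-countdown x N g x≤N)))
  where
  F = λ k → if k ≤ᵇ suc x then g (suc x ∸ k) else 0
  F-suc : ∀ k → F (suc k) ≡ (if k ≤ᵇ x then g (x ∸ k) else 0)
  F-suc k = cong (λ b → if b then g (x ∸ k) else 0) (≤ᵇ-suc k x)

sum≤-truncate : ∀ {x y} g → y ≤ x → (∀ w → y < w → g w ≡ 0) → sum≤ x g ≡ sum≤ y g
sum≤-truncate {zero}  g z≤n _ = refl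
sum≤-truncate {suc x} {y} g y≤x g≡0 with m≤n⇒m<n∨m≡n y≤x
... | inj₂ refl       = refl
... | inj₁ (s≤s y≤x′) = trans (cong (_+ sum≤ x g) (g≡0 (suc x) (s≤s y≤x′))) (sum≤-truncate g y≤x′ g≡0)

sum-map-zero : ∀ {A : Set} (F : A → ℕ) xs → (∀ x → F x ≡ 0) → sum (map F xs) ≡ 0
sum-map-zero F []       _    = refl
sum-map-zero F (x ∷ xs) F≡0 = cong₂ _+_ (F≡0 x) (sum-map-zero F xs F≡0)

sum-map-positive : ∀ {A : Set} (F : A → ℕ) xs → 1 ≤ sum (map F xs) → ∃[ x ] 1 ≤ F x
sum-map-positive F (x ∷ xs) pos with F x in Fx
... | zero  = sum-map-positive F xs pos
... | suc _ = x , subst (1 ≤_) (sym Fx) (s≤s z≤n)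

if-sum< : ∀ b n f → (if b then sum< n f else 0) ≡ sum< n (λ k → if b then f k else 0)
if-sum< true  n f = refl
if-sum< false n f = sym (sum<-zero n _ (λ _ → refl))

if-∧ : ∀ a b (x : ℕ) → (if a then (if b then x else 0) else 0) ≡ (if a ∧ b then x else 0)
if-∧ true  b x = refl
if-∧ false b x = refl

if-then-0 : ∀ b {x} → x ≡ 0 → (if b then x else 0) ≡ 0
if-then-0 true  x≡0 = x≡0
if-then-0 false _   = refl

if-false : ∀ {b} x → b ≡ false → (if b then x else 0) ≡ 0
if-false x refl = refl

if-≡ᵇ-miss : ∀ {a b} x → a ≢ b → (if a ≡ᵇ b then x else 0) ≡ 0
if-≡ᵇ-miss {a} {b} x a≢b with a ≡ᵇ b in eq
... | false = refl
... | true  = ⊥-elim (a≢b (≡ᵇ⇒≡ a b (from T-≡ eq)))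

zeros : ∀ r → Weight r
zeros r = vec r (λ _ → 0)

scale-zeros : ∀ k r → scale k (zeros r) ≡ zeros r
scale-zeros k zero    = refl
scale-zeros k (suc r) = cong₂ _∷_ (*-zeroʳ k) (scale-zeros k r)

zeros-≤ʷ : ∀ {r} (ρ : Weight r) → (zeros r ≤ʷ ρ) ≡ true
zeros-≤ʷ []      = refl
zeros-≤ʷ (_ ∷ ρ) = zeros-≤ʷ ρ

minus-zeros : ∀ {r} (ρ : Weight r) → minus ρ (zeros r) ≡ ρ
minus-zeros []      = refl
minus-zeros (x ∷ ρ) = cong (x ∷_) (minus-zeros ρ)

scale-zero-≤ʷ : ∀ {r} (u ξ : Weight r) → (scale 0 u ≤ʷ ξ) ≡ true
scale-zero-≤ʷ []      []      = refl
scale-zero-≤ʷ (_ ∷ u) (_ ∷ ξ) = scale-zero-≤ʷ u ξ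

minus-scale-zero : ∀ {r} (ξ u : Weight r) → minus ξ (scale 0 u) ≡ ξ
minus-scale-zero []      []      = refl
minus-scale-zero (x ∷ ξ) (_ ∷ u) = cong (x ∷_) (minus-scale-zero ξ u)

scale-one : ∀ {r} (u : Weight r) → scale 1 u ≡ u
scale-one []      = refl
scale-one (a ∷ u) = cong₂ _∷_ (+-identityʳ a) (scale-one u)

scale-0∷ : ∀ {r} k (u : Weight r) → scale k (0 ∷ u) ≡ 0 ∷ scale k u
scale-0∷ k u = cong (_∷ scale k u) (*-zeroʳ k)

scale-1∷ : ∀ {r} k (u : Weight r) → scale k (1 ∷ u) ≡ k ∷ scale k u
scale-1∷ k u = cong (_∷ scale k u) (*-identityʳ k)

height-scale : ∀ {r} k (u : Weight r) → height (scale k u) ≡ k * height u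
height-scale k []      = sym (*-zeroʳ k)
height-scale k (a ∷ u) = trans (cong (k * a +_) (height-scale k u)) (sym (*-distribˡ-+ k a _))

height-minus : ∀ {r} (ξ u : Weight r) → height (minus ξ u) ≤ height ξ
height-minus []      []      = z≤n
height-minus (x ∷ ξ) (a ∷ u) = +-mono-≤ (m∸n≤m x a) (height-minus ξ u)

≤ʷ-height : ∀ {r} (u v : Weight r) → T (u ≤ʷ v) → height u ≤ height v
≤ʷ-height []      []      _   = z≤n
≤ʷ-height (a ∷ u) (x ∷ v) u≤v =
  let a≤x , u≤v′ = to T-∧ u≤v in +-mono-≤ (≤ᵇ⇒≤ a x a≤x) (≤ʷ-height u v u≤v′)

minus-≤ʷ : ∀ {r} (ξ b u : Weight r) → T (ξ ≤ʷ b) → T (minus ξ u ≤ʷ b)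
minus-≤ʷ []      []      []      _   = _
minus-≤ʷ (x ∷ ξ) (c ∷ b) (a ∷ u) ξ≤b =
  let x≤c , ξ≤b′ = to T-∧ ξ≤b
  in from T-∧ (≤⇒≤ᵇ (≤-trans (m∸n≤m x a) (≤ᵇ⇒≤ x c x≤c)) , minus-≤ʷ ξ b u ξ≤b′)

scale-≤ʷ-trans : ∀ {r} k (α ξ b : Weight r) → T (scale (suc k) α ≤ʷ ξ) → T (ξ ≤ʷ b) → T (α ≤ʷ b)
scale-≤ʷ-trans k []      []      []      _   _   = _
scale-≤ʷ-trans k (a ∷ α) (x ∷ ξ) (c ∷ b) kα≤ξ ξ≤b =
  let ka≤x , kα≤ξ′ = to T-∧ kα≤ξ
      x≤c  , ξ≤b′  = to T-∧ ξ≤b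
      a≤c = ≤-trans (m≤n*m a (suc k)) (≤-trans (≤ᵇ⇒≤ _ x ka≤x) (≤ᵇ⇒≤ x c x≤c))
  in from T-∧ (≤⇒≤ᵇ a≤c , scale-≤ʷ-trans k α ξ b kα≤ξ′ ξ≤b′)

≤ʷ-minus : ∀ {r} (ξ u v : Weight r) → ((u ≤ʷ ξ) ∧ (v ≤ʷ minus ξ u)) ≡ (zipWith _+_ u v ≤ʷ ξ)
≤ʷ-minus []      []      []      = refl
≤ʷ-minus (x ∷ ξ) (a ∷ u) (b ∷ v) = trans
  (∧-interchange (a ≤ᵇ x) (u ≤ʷ ξ) (b ≤ᵇ x ∸ a) (v ≤ʷ minus ξ u))
  (cong₂ _∧_ (≤ᵇ-∸ a b x) (≤ʷ-minus ξ u v))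

minus-minus : ∀ {r} (ξ u v : Weight r) → minus (minus ξ u) v ≡ minus ξ (zipWith _+_ u v)
minus-minus []      []      []      = refl
minus-minus (x ∷ ξ) (a ∷ u) (b ∷ v) = cong₂ _∷_ (∸-+-assoc x a b) (minus-minus ξ u v)

vec-∷ : ∀ r (f g : ℕ → ℕ) a → f 1 ≡ a → (∀ m → f (2 + m) ≡ g (1 + m)) → vec (suc r) f ≡ a ∷ vec r g
vec-∷ r f g a f₁ shift = cong₂ _∷_ f₁ (tabulate-cong (λ k → shift (toℕ k)))

seg-suc : ∀ a b m → seg (suc a) (suc b) (suc m) ≡ seg a b m
seg-suc a b m = cong₂ (λ x y → if x ∧ y then 1 else 0) (≤ᵇ-suc a m) (≤ᵇ-suc m b)

seg-inside : ∀ {i j m} → i ≤ m → m ≤ j → seg i j m ≡ 1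
seg-inside i≤m m≤j = cong₂ (λ x y → if x ∧ y then 1 else 0) (to T-≡ (≤⇒≤ᵇ i≤m)) (to T-≡ (≤⇒≤ᵇ m≤j))

-- Counting representations

countRemainder : ∀ {r} → List (Weight r) → Weight r → Weight r → ℕ
countRemainder Φ ξ γ = if γ ≤ʷ ξ then countReps Φ (minus ξ γ) else 0

countRemainder-fits : ∀ {r} (Φ : List (Weight r)) {ξ γ} → (γ ≤ʷ ξ) ≡ true →
                      countRemainder Φ ξ γ ≡ countReps Φ (minus ξ γ)
countRemainder-fits Φ {ξ} {γ} fits = cong (λ b → if b then countReps Φ (minus ξ γ) else 0) fits

countRemainder-misfit : ∀ {r} (Φ : List (Weight r)) {ξ γ} → (γ ≤ʷ ξ) ≡ false → countRemainder Φ ξ γ ≡ 0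
countRemainder-misfit Φ {ξ} {γ} misfit = cong (λ b → if b then countReps Φ (minus ξ γ) else 0) misfit

countRemainder-scale-zero : ∀ {r} (Φ : List (Weight r)) ξ α → countRemainder Φ ξ (scale 0 α) ≡ countReps Φ ξ
countRemainder-scale-zero Φ ξ α =
  trans (countRemainder-fits Φ (scale-zero-≤ʷ α ξ)) (cong (countReps Φ) (minus-scale-zero ξ α))

countRemainder-zeros : ∀ {m} (Φ : List (Weight m)) ρ → countRemainder Φ ρ (zeros m) ≡ countReps Φ ρ
countRemainder-zeros Φ ρ = trans (countRemainder-fits Φ (zeros-≤ʷ ρ)) (cong (countReps Φ) (minus-zeros ρ))

countRemainder-simpleRoot : ∀ {m} (Φ : List (Weight (suc m))) x ρ →
                            countRemainder Φ (suc x ∷ ρ) (1 ∷ zeros m) ≡ countReps Φ (x ∷ ρ)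
countRemainder-simpleRoot {m} Φ x ρ =
  trans (countRemainder-fits Φ {suc x ∷ ρ} {1 ∷ zeros m} (zeros-≤ʷ ρ)) (cong (λ ρ′ → countReps Φ (x ∷ ρ′)) (minus-zeros ρ))

countRemainder-+ : ∀ {r} (Φ : List (Weight r)) ξ u v →
                   (if u ≤ʷ ξ then countRemainder Φ (minus ξ u) v else 0) ≡ countRemainder Φ ξ (zipWith _+_ u v)
countRemainder-+ Φ ξ u v = trans (if-∧ (u ≤ʷ ξ) _ _)
  (cong₂ (λ b ρ → if b then countReps Φ ρ else 0) (≤ʷ-minus ξ u v) (minus-minus ξ u v))

countReps-∷-cong : ∀ {r} α (Φ Ψ : List (Weight r)) ξ →
                   (∀ γ → countReps Φ (minus ξ γ) ≡ countReps Ψ (minus ξ γ)) →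
                   countReps (α ∷ Φ) ξ ≡ countReps (α ∷ Ψ) ξ
countReps-∷-cong α Φ Ψ ξ eq = sum<-cong (suc (height ξ)) (λ k → cong (λ c → if scale k α ≤ʷ ξ then c else 0) (eq (scale k α)))

countReps-∷-unused : ∀ {r} α (Φ : List (Weight r)) ξ → (∀ k → countRemainder Φ ξ (scale (suc k) α) ≡ 0) →
                     countReps (α ∷ Φ) ξ ≡ countReps Φ ξ
countReps-∷-unused α Φ ξ unused = begin
  sum< (suc (height ξ)) F  ≡⟨ sym (sum<-extend {b = suc (height ξ)} F (s≤s z≤n) (λ { (suc k) _ → unused k })) ⟩
  F 0 + 0                  ≡⟨ +-identityʳ (F 0) ⟩
  F 0                      ≡⟨ countRemainder-scale-zero Φ ξ α ⟩
  countReps Φ ξ            ∎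
  where
  open ≡-Reasoning
  F = λ k → countRemainder Φ ξ (scale k α)

countReps-∷-atMostOnce : ∀ {r} α (Φ : List (Weight r)) ξ → 1 ≤ height ξ →
                         (∀ k → countRemainder Φ ξ (scale (2 + k) α) ≡ 0) →
                         countReps (α ∷ Φ) ξ ≡ countReps Φ ξ + countRemainder Φ ξ α
countReps-∷-atMostOnce α Φ ξ 1≤h unused = begin
  sum< (suc (height ξ)) F
    ≡⟨ sum<-extend {b = suc (height ξ)} F (s≤s 1≤h) (λ { (suc zero) (s≤s ()) ; (suc (suc k)) _ → unused k }) ⟨
  F 0 + (F 1 + 0)
    ≡⟨ cong₂ _+_ (countRemainder-scale-zero Φ ξ α) (trans (+-identityʳ (F 1)) (cong (countRemainder Φ ξ) (scale-one α))) ⟩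
  countReps Φ ξ + countRemainder Φ ξ α ∎
  where
  open ≡-Reasoning
  F = λ k → countRemainder Φ ξ (scale k α)

countReps-∷-bound : ∀ {r} {α : Weight r} Φ ξ {N} → NonZero (height α) → height ξ ≤ N →
                    countReps (α ∷ Φ) ξ ≡ sum< (suc N) (λ k → countRemainder Φ ξ (scale k α))
countReps-∷-bound {α = α} Φ ξ nz h≤N = sum<-extend _ (s≤s h≤N) unused
  where
  unused : ∀ k → suc (height ξ) ≤ k → countRemainder Φ ξ (scale k α) ≡ 0
  unused k h<k with scale k α ≤ʷ ξ in fits
  ... | false = refl
  ... | true  = ⊥-elim (<⇒≱ h<k (begin
    k                    ≤⟨ m≤m*n k (height α) {{nz}} ⟩
    k * height α         ≡⟨ height-scale k α ⟨
    height (scale k α)   ≤⟨ ≤ʷ-height (scale k α) ξ (from T-≡ fits) ⟩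
    height ξ             ∎))
    where open ≤-Reasoning

countReps-∷∷ : ∀ {r} (α : Weight r) {β} Φ ξ → NonZero (height β) →
               countReps (α ∷ β ∷ Φ) ξ ≡
               sum< (suc (height ξ)) (λ k → sum< (suc (height ξ)) (λ m →
                 countRemainder Φ ξ (zipWith _+_ (scale k α) (scale m β))))
countReps-∷∷ α {β} Φ ξ nzβ = sum<-cong N λ k → let kα = scale k α in begin
  (if kα ≤ʷ ξ then countReps (β ∷ Φ) (minus ξ kα) else 0)
    ≡⟨ cong (λ c → if kα ≤ʷ ξ then c else 0) (countReps-∷-bound Φ (minus ξ kα) nzβ (height-minus ξ kα)) ⟩
  (if kα ≤ʷ ξ then sum< N (λ m → countRemainder Φ (minus ξ kα) (scale m β)) else 0)
    ≡⟨ if-sum< (kα ≤ʷ ξ) N _ ⟩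
  sum< N (λ m → if kα ≤ʷ ξ then countRemainder Φ (minus ξ kα) (scale m β) else 0)
    ≡⟨ sum<-cong N (λ m → countRemainder-+ Φ ξ kα (scale m β)) ⟩
  sum< N (λ m → countRemainder Φ ξ (zipWith _+_ kα (scale m β))) ∎
  where
  open ≡-Reasoning
  N = suc (height ξ)

countReps-swap : ∀ {r} (α β : Weight r) Φ ξ → NonZero (height α) → NonZero (height β) →
                 countReps (α ∷ β ∷ Φ) ξ ≡ countReps (β ∷ α ∷ Φ) ξ
countReps-swap α β Φ ξ nzα nzβ = begin
  countReps (α ∷ β ∷ Φ) ξ
    ≡⟨ countReps-∷∷ α Φ ξ nzβ ⟩
  sum< N (λ k → sum< N (λ m → countRemainder Φ ξ (zipWith _+_ (scale k α) (scale m β))))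
    ≡⟨ sum<-cong N (λ k → sum<-cong N (λ m → cong (countRemainder Φ ξ) (zipWith-comm +-comm (scale k α) (scale m β)))) ⟩
  sum< N (λ k → sum< N (λ m → countRemainder Φ ξ (zipWith _+_ (scale m β) (scale k α))))
    ≡⟨ sum<-swap N N _ ⟩
  sum< N (λ m → sum< N (λ k → countRemainder Φ ξ (zipWith _+_ (scale m β) (scale k α))))
    ≡⟨ countReps-∷∷ β Φ ξ nzα ⟨
  countReps (β ∷ α ∷ Φ) ξ ∎
  where
  open ≡-Reasoning
  N = suc (height ξ)

-- Zero roots must be excluded: countReps caps the multiplicity of a zero root at the height of the
-- remaining weight, which depends on the order of the list.
countReps-↭ : ∀ {r} {Φ Ψ : List (Weight r)} → All (NonZero ∘ height) Φ → Φ ↭ Ψ →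
              ∀ ξ → countReps Φ ξ ≡ countReps Ψ ξ
countReps-↭ nz             ↭.refl          ξ = refl
countReps-↭ (_ ∷ nz)       (↭.prep {xs} {ys} α p) ξ = countReps-∷-cong α xs ys ξ (λ γ → countReps-↭ nz p _)
countReps-↭ (nzα ∷ nzβ ∷ nz) (↭.swap {xs} {ys} α β p) ξ = trans (countReps-swap α β xs ξ nzα nzβ)
  (countReps-∷-cong β (α ∷ xs) (α ∷ ys) ξ (λ γ → countReps-∷-cong α xs ys _ (λ δ → countReps-↭ nz p _)))
countReps-↭ nz             (↭.trans p q)   ξ = trans (countReps-↭ nz p ξ) (countReps-↭ (All-resp-↭ p nz) q ξ)

module _ {r} (P : Weight r → Bool)
         (P-minus : ∀ ξ u → T (P ξ) → T (P (minus ξ u)))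
         (P-scale : ∀ k α ξ → T (scale (suc k) α ≤ʷ ξ) → T (P ξ) → T (P α)) where

  countReps-filter : ∀ Φ ξ → T (P ξ) → countReps Φ ξ ≡ countReps (filterᵇ P Φ) ξ
  countReps-filter []      ξ Pξ = refl
  countReps-filter (α ∷ Φ) ξ Pξ with P α in Pα
  ... | true  = countReps-∷-cong α Φ (filterᵇ P Φ) ξ (λ γ → countReps-filter Φ _ (P-minus ξ γ Pξ))
  ... | false = trans (countReps-∷-unused α Φ ξ (λ k → countRemainder-misfit Φ (misfit k))) (countReps-filter Φ ξ Pξ)
    where
    misfit : ∀ k → (scale (suc k) α ≤ʷ ξ) ≡ false
    misfit k with scale (suc k) α ≤ʷ ξ in fits
    ... | false = refl
    ... | true  = ⊥-elim (subst T Pα (P-scale k α ξ (from T-≡ fits) Pξ))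

-- Weights whose last three coefficients are at most 1

last3≤1 : ∀ {n} → Weight (3 + n) → Bool
last3≤1 {zero}  ξ       = ξ ≤ʷ (1 ∷ 1 ∷ 1 ∷ [])
last3≤1 {suc n} (_ ∷ ξ) = last3≤1 ξ

last3≤1-minus : ∀ {n} (ξ u : Weight (3 + n)) → T (last3≤1 ξ) → T (last3≤1 (minus ξ u))
last3≤1-minus {zero}  ξ       u       = minus-≤ʷ ξ _ u
last3≤1-minus {suc n} (_ ∷ ξ) (_ ∷ u) = last3≤1-minus ξ u

last3≤1-scale : ∀ {n} k (α ξ : Weight (3 + n)) → T (scale (suc k) α ≤ʷ ξ) → T (last3≤1 ξ) → T (last3≤1 α)
last3≤1-scale {zero}  k α       ξ       = scale-≤ʷ-trans k α ξ _
last3≤1-scale {suc n} k (_ ∷ α) (_ ∷ ξ) kα≤ξ = last3≤1-scale k α ξ (proj₂ (to T-∧ kα≤ξ))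

countReps-last3≤1 : ∀ {n} Φ (ξ : Weight (3 + n)) → T (last3≤1 ξ) → countReps Φ ξ ≡ countReps (filterᵇ last3≤1 Φ) ξ
countReps-last3≤1 = countReps-filter last3≤1 last3≤1-minus last3≤1-scale

last3≤1-vec : ∀ k f → last3≤1 (vec (3 + k) f) ≡ ((f (1 + k) ≤ᵇ 1) ∧ ((f (2 + k) ≤ᵇ 1) ∧ ((f (3 + k) ≤ᵇ 1) ∧ true)))
last3≤1-vec zero    f = refl
last3≤1-vec (suc k) f = last3≤1-vec k (f ∘ suc)

last3≤1-vec-ones : ∀ k f → f (1 + k) ≡ 1 → f (2 + k) ≡ 1 → f (3 + k) ≡ 1 → T (last3≤1 (vec (3 + k) f))
last3≤1-vec-ones k f f₁ f₂ f₃ rewrite last3≤1-vec k f | f₁ | f₂ | f₃ = _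

last3≤1-vec-big : ∀ k f → 2 ≤ f (1 + k) → last3≤1 (vec (3 + k) f) ≡ false
last3≤1-vec-big k f big with f (1 + k) | big | last3≤1-vec k f
... | suc (suc _) | _      | eq = eq
... | suc zero    | s≤s () | _

last3≤1-zeros : ∀ n → T (last3≤1 (zeros (3 + n)))
last3≤1-zeros zero    = _
last3≤1-zeros (suc n) = last3≤1-zeros n

filter-last3≤1-∷ : ∀ {n} a (xs : List (Weight (3 + n))) → filterᵇ last3≤1 (map (a ∷_) xs) ≡ map (a ∷_) (filterᵇ last3≤1 xs)
filter-last3≤1-∷ a []       = refl
filter-last3≤1-∷ a (x ∷ xs) with last3≤1 x
... | true  = cong ((a ∷ x) ∷_) (filter-last3≤1-∷ a xs)
... | false = filter-last3≤1-∷ a xs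

filter-last3≤1-map-++ : ∀ {n} (V : (ℕ → ℕ) → Weight (3 + n)) X Y →
                filterᵇ last3≤1 (map V (X ++ Y)) ≡ filterᵇ last3≤1 (map V X) ++ filterᵇ last3≤1 (map V Y)
filter-last3≤1-map-++ V X Y = trans (cong (filterᵇ last3≤1) (map-++ V X Y)) (filter-++ (T? ∘ last3≤1) (map V X) (map V Y))

-- Adding a node on the left

addNode : ∀ {m} → List (Weight m) → List (Weight m) → List (Weight (suc m))
addNode H Φ = map (1 ∷_) H ++ map (0 ∷_) Φ

countReps-0∷-zero : ∀ {m} (Φ : List (Weight m)) η → countReps (map (0 ∷_) Φ) (0 ∷ η) ≡ countReps Φ η
countReps-0∷-zero []      η = refl
countReps-0∷-zero (α ∷ Φ) η = sum<-cong (suc (height η)) λ k →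
  trans (cong (countRemainder (map (0 ∷_) Φ) (0 ∷ η)) (scale-0∷ k α))
        (cong (λ c → if scale k α ≤ʷ η then c else 0) (countReps-0∷-zero Φ _))

countReps-0∷-suc : ∀ {m} (Φ : List (Weight m)) x η → countReps (map (0 ∷_) Φ) (suc x ∷ η) ≡ 0
countReps-0∷-suc []      x η = refl
countReps-0∷-suc (α ∷ Φ) x η = sum<-zero (suc (height (suc x ∷ η))) _ λ k →
  trans (cong (countRemainder (map (0 ∷_) Φ) (suc x ∷ η)) (scale-0∷ k α))
        (if-then-0 (scale k α ≤ʷ η) (countReps-0∷-suc Φ x _))

countReps-addNode-0 : ∀ {m} (H Φ : List (Weight m)) η → countReps (addNode H Φ) (0 ∷ η) ≡ countReps Φ η
countReps-addNode-0 []      Φ η = countReps-0∷-zero Φ η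
countReps-addNode-0 (β ∷ H) Φ η =
  trans (countReps-∷-unused (1 ∷ β) (addNode H Φ) (0 ∷ η) (λ k → refl)) (countReps-addNode-0 H Φ η)

countReps-addNode-1 : ∀ {m} (H Φ : List (Weight m)) η →
                      countReps (addNode H Φ) (1 ∷ η) ≡ sum (map (countRemainder Φ η) H)
countReps-addNode-1 []      Φ η = countReps-0∷-suc Φ 0 η
countReps-addNode-1 (β ∷ H) Φ η = begin
  countReps ((1 ∷ β) ∷ addNode H Φ) (1 ∷ η)
    ≡⟨ countReps-∷-atMostOnce (1 ∷ β) (addNode H Φ) (1 ∷ η) (s≤s z≤n) (λ k → refl) ⟩
  countReps (addNode H Φ) (1 ∷ η) + countRemainder (addNode H Φ) (1 ∷ η) (1 ∷ β)
    ≡⟨ cong₂ _+_ (countReps-addNode-1 H Φ η)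
                 (cong (λ c → if β ≤ʷ η then c else 0) (countReps-addNode-0 H Φ (minus η β))) ⟩
  sum (map (countRemainder Φ η) H) + countRemainder Φ η β
    ≡⟨ +-comm _ (countRemainder Φ η β) ⟩
  countRemainder Φ η β + sum (map (countRemainder Φ η) H) ∎
  where open ≡-Reasoning

countReps-addNode-splits : ∀ {m} (H Φ : List (Weight m)) η →
                           countReps (addNode H Φ) (1 ∷ η) ≡
                           sum (map (countRemainder (addNode H Φ) (1 ∷ η) ∘ (1 ∷_)) H)
countReps-addNode-splits H Φ η = trans (countReps-addNode-1 H Φ η) (cong sum (map-cong
  (λ β → cong (λ c → if β ≤ʷ η then c else 0) (sym (countReps-addNode-0 H Φ (minus η β)))) H))

countReps-addNode-vanish : ∀ {m} (H : List (Weight m)) Φ {x y} η → y < x →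
                           countReps (addNode (map (1 ∷_) H) Φ) (x ∷ y ∷ η) ≡ 0
countReps-addNode-vanish []      Φ {suc x} η _   = countReps-0∷-suc Φ x _
countReps-addNode-vanish (β ∷ H) Φ {x} {y} η y<x = sum<-zero (suc (height (x ∷ y ∷ η))) _ λ k →
  trans (cong (countRemainder Ψ (x ∷ y ∷ η)) (trans (scale-1∷ k _) (cong (k ∷_) (scale-1∷ k β))))
        (vanish k)
  where
  Ψ = addNode (map (1 ∷_) H) Φ
  vanish : ∀ k → (if (k ≤ᵇ x) ∧ ((k ≤ᵇ y) ∧ (scale k β ≤ʷ η))
                  then countReps Ψ ((x ∸ k) ∷ (y ∸ k) ∷ minus η (scale k β)) else 0) ≡ 0
  vanish k with k ≤ᵇ y in k≤y
  ... | false = if-false _ (∧-zeroʳ (k ≤ᵇ x))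
  ... | true  = if-then-0 ((k ≤ᵇ x) ∧ (scale k β ≤ʷ η))
      (countReps-addNode-vanish H Φ _ (∸-monoˡ-< y<x (≤ᵇ⇒≤ k y (from T-≡ k≤y))))

countReps-simpleRoot : ∀ {m} (Ψ : List (Weight (suc m))) x ρ →
                       countReps ((1 ∷ zeros m) ∷ Ψ) (x ∷ ρ) ≡ sum≤ x (λ w → countReps Ψ (w ∷ ρ))
countReps-simpleRoot {m} Ψ x ρ =
  trans (sum<-cong (suc (x + height ρ)) uses-k) (sum<-countdown x _ _ (m≤m+n x (height ρ)))
  where
  uses-k : ∀ k → countRemainder Ψ (x ∷ ρ) (scale k (1 ∷ zeros m)) ≡ (if k ≤ᵇ x then countReps Ψ ((x ∸ k) ∷ ρ) else 0)
  uses-k k = begin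
    countRemainder Ψ (x ∷ ρ) (scale k (1 ∷ zeros m))
      ≡⟨ cong (countRemainder Ψ (x ∷ ρ)) (trans (scale-1∷ k _) (cong (k ∷_) (scale-zeros k m))) ⟩
    (if (k ≤ᵇ x) ∧ (zeros m ≤ʷ ρ) then countReps Ψ ((x ∸ k) ∷ minus ρ (zeros m)) else 0)
      ≡⟨ cong₂ (λ b ρ′ → if (k ≤ᵇ x) ∧ b then countReps Ψ ((x ∸ k) ∷ ρ′) else 0) (zeros-≤ʷ ρ) (minus-zeros ρ) ⟩
    (if (k ≤ᵇ x) ∧ true then countReps Ψ ((x ∸ k) ∷ ρ) else 0)
      ≡⟨ cong (λ b → if b then countReps Ψ ((x ∸ k) ∷ ρ) else 0) (∧-identityʳ (k ≤ᵇ x)) ⟩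
    (if k ≤ᵇ x then countReps Ψ ((x ∸ k) ∷ ρ) else 0) ∎
    where open ≡-Reasoning

-- bigCount R f counts the 2 ≤ m ≤ R with f m ≥ 2.
bigCount : ℕ → (ℕ → ℕ) → ℕ
bigCount (suc (suc R)) f = (if 2 ≤ᵇ f 2 then 1 else 0) + bigCount (suc R) (f ∘ suc)
bigCount _             f = 0

bigCount-cong : ∀ R {f g} → (∀ m → 2 ≤ m → f m ≡ g m) → bigCount R f ≡ bigCount R g
bigCount-cong zero          _  = refl
bigCount-cong (suc zero)    _  = refl
bigCount-cong (suc (suc R)) eq = cong₂ _+_ (cong (λ x → if 2 ≤ᵇ x then 1 else 0) (eq 2 ≤-refl))
                                           (bigCount-cong (suc R) (λ m 2≤m → eq (suc m) (m≤n⇒m≤1+n 2≤m)))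

bigCount-ones : ∀ R → bigCount R (λ _ → 1) ≡ 0
bigCount-ones zero          = refl
bigCount-ones (suc zero)    = refl
bigCount-ones (suc (suc R)) = bigCount-ones (suc R)

bigCount-bump : ∀ R g {p c} → 2 ≤ p → p ≤ R → g p ≡ 1 → 1 ≤ c →
                bigCount R (λ m → g m + (if p ≡ᵇ m then c else 0)) ≡ suc (bigCount R g)
bigCount-bump (suc (suc R)) g {2} {suc c} _ _ g₂ _ = begin
  (if 2 ≤ᵇ g 2 + suc c then 1 else 0) + bigCount (suc R) (λ m → g (suc m) + (if 2 ≡ᵇ suc m then suc c else 0))
    ≡⟨ cong₂ _+_ (cong (λ x → if 2 ≤ᵇ x + suc c then 1 else 0) g₂) (bigCount-cong (suc R) unbumped) ⟩
  suc (bigCount (suc R) (g ∘ suc))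
    ≡⟨ cong (λ x → suc ((if 2 ≤ᵇ x then 1 else 0) + bigCount (suc R) (g ∘ suc))) g₂ ⟨
  suc (bigCount (suc (suc R)) g) ∎
  where
  open ≡-Reasoning
  unbumped : ∀ m → 2 ≤ m → g (suc m) + (if 2 ≡ᵇ suc m then suc c else 0) ≡ g (suc m)
  unbumped (suc (suc m)) _ = +-identityʳ _
  unbumped (suc zero) (s≤s ())
bigCount-bump (suc (suc R)) g {suc (suc (suc p))} (s≤s (s≤s _)) (s≤s p≤R) gp c≥1 = begin
  (if 2 ≤ᵇ g 2 + 0 then 1 else 0) + bigCount (suc R) (λ m → g (suc m) + (if suc (suc p) ≡ᵇ m then _ else 0))
    ≡⟨ cong₂ _+_ (cong (λ x → if 2 ≤ᵇ x then 1 else 0) (+-identityʳ (g 2)))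
                 (bigCount-bump (suc R) (g ∘ suc) (s≤s (s≤s z≤n)) p≤R gp c≥1) ⟩
  (if 2 ≤ᵇ g 2 then 1 else 0) + suc (bigCount (suc R) (g ∘ suc))
    ≡⟨ +-suc _ _ ⟩
  suc (bigCount (suc (suc R)) g) ∎
  where open ≡-Reasoning
bigCount-bump _             g {2}             {zero} _                _         _ ()
bigCount-bump zero          g {suc _}         _                ()        _ _
bigCount-bump (suc zero)    g {suc (suc _)}   _                (s≤s ())  _ _
bigCount-bump _             g {zero}          ()               _         _ _
bigCount-bump _             g {suc zero}      (s≤s ())         _         _ _

not-big : ∀ {x} → 1 ≤ x → (2 ≤ x → ⊥) → x ≡ 1
not-big {suc zero}    _ _     = refl
not-big {suc (suc x)} _ small = ⊥-elim (small (s≤s (s≤s z≤n)))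

record Admissible (n : ℕ) (f : ℕ → ℕ) : Set where
  field
    positive : ∀ m → 1 ≤ f m
    sparse   : ∀ m → 2 ≤ f m → 2 ≤ f (suc m) → ⊥
    end₁     : f (1 + n) ≡ 1
    end₂     : f (2 + n) ≡ 1
    end₃     : f (3 + n) ≡ 1

small-after : ∀ {n f} → Admissible n f → ∀ m → 2 ≤ f m → f (suc m) ≡ 1
small-after adm m big = not-big (positive (suc m)) (sparse m big)
  where open Admissible adm

small-before : ∀ {n f} → Admissible n f → ∀ m → 2 ≤ f (suc m) → f m ≡ 1
small-before adm m big = not-big (positive m) (λ big′ → sparse m big′ big)
  where open Admissible adm

admissible-suc : ∀ {n f} → Admissible (suc n) f → Admissible n (f ∘ suc)
admissible-suc adm = record
  { positive = positive ∘ suc ; sparse = sparse ∘ suc ; end₁ = end₁ ; end₂ = end₂ ; end₃ = end₃ }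
  where open Admissible adm

admissible-last3≤1 : ∀ {n f} → Admissible n f → T (last3≤1 (vec (3 + n) f))
admissible-last3≤1 {n} {f} adm = last3≤1-vec-ones n f end₁ end₂ end₃
  where open Admissible adm

small-or-big : ∀ x → 1 ≤ x → x ≡ 1 ⊎ ∃[ w ] x ≡ 2 + w
small-or-big (suc zero)    _ = inj₁ refl
small-or-big (suc (suc w)) _ = inj₂ (w , refl)

bigCount-small : ∀ n f → f 2 ≡ 1 → bigCount (4 + n) f ≡ bigCount (3 + n) (f ∘ suc)
bigCount-small n f f₂ = cong (λ y → (if 2 ≤ᵇ y then 1 else 0) + bigCount (3 + n) (f ∘ suc)) f₂

bigCount-big : ∀ n f w → Admissible (2 + n) f → f 2 ≡ 2 + w → bigCount (5 + n) f ≡ suc (bigCount (3 + n) (f ∘ suc ∘ suc))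
bigCount-big n f w adm f₂ =
  cong₂ (λ a b → (if 2 ≤ᵇ a then 1 else 0) + ((if 2 ≤ᵇ b then 1 else 0) + bigCount (3 + n) (f ∘ suc ∘ suc)))
        f₂ (small-after adm 2 (subst (2 ≤_) (sym f₂) (m≤m+n 2 w)))

doubling : ∀ {c p s c′ s′} → c * 4 ^ s ≡ p * 5 ^ s → c′ ≡ 2 * c → s′ ≡ s → c′ * 4 ^ s′ ≡ (2 * p) * 5 ^ s′
doubling {c} {p} {s} eq refl refl = begin
  (2 * c) * 4 ^ s  ≡⟨ *-assoc 2 c _ ⟩
  2 * (c * 4 ^ s)  ≡⟨ cong (2 *_) eq ⟩
  2 * (p * 5 ^ s)  ≡⟨ *-assoc 2 p _ ⟨
  (2 * p) * 5 ^ s  ∎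
  where open ≡-Reasoning

quintupling : ∀ {c p s c′ s′} → c * 4 ^ s ≡ p * 5 ^ s → c′ ≡ 5 * c → s′ ≡ suc s →
              c′ * 4 ^ s′ ≡ (2 * (2 * p)) * 5 ^ s′
quintupling {c} {p} {s} eq refl refl = begin
  (5 * c) * (4 * 4 ^ s)        ≡⟨ regroup c (4 ^ s) ⟩
  20 * (c * 4 ^ s)             ≡⟨ cong (20 *_) eq ⟩
  20 * (p * 5 ^ s)             ≡⟨ regroup′ p (5 ^ s) ⟩
  (2 * (2 * p)) * (5 * 5 ^ s)  ∎
  where
  open ≡-Reasoning
  regroup : ∀ a x → (5 * a) * (4 * x) ≡ 20 * (a * x)
  regroup = solve-∀
  regroup′ : ∀ a y → 20 * (a * y) ≡ (2 * (2 * a)) * (5 * y)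
  regroup′ = solve-∀

-- K n is K₀ with n nodes attached to the left of α₁, and H n lists the tails of the roots of K n
-- through its first node.
module Extension (H₀ : List (Weight 2)) (K₀ : List (Weight 3)) where

  H : ∀ n → List (Weight (2 + n))
  H zero    = H₀
  H (suc n) = zeros (3 + n) ∷ map (1 ∷_) (H n)

  K : ∀ n → List (Weight (3 + n))
  K zero    = K₀
  K (suc n) = addNode (H (suc n)) (K n)

  SplitsAt : ∀ n → Weight (2 + n) → Set
  SplitsAt n η = countReps (K n) (1 ∷ η) ≡ sum (map (countRemainder (K n) (1 ∷ η) ∘ (1 ∷_)) (H n))

  count-K-x1 : ∀ n {x} η → 1 ≤ x → SplitsAt n η → countReps (K (suc n)) (x ∷ 1 ∷ η) ≡ 2 * countReps (K n) (1 ∷ η)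
  count-K-x1 n {x} η 1≤x splits = begin
    countReps (K (suc n)) (x ∷ 1 ∷ η)  ≡⟨ countReps-simpleRoot Ψ x (1 ∷ η) ⟩
    sum≤ x g                           ≡⟨ sum≤-truncate g 1≤x (λ w 1<w → countReps-addNode-vanish (H n) (K n) η 1<w) ⟩
    g 1 + g 0                          ≡⟨ cong₂ _+_ g₁ (countReps-addNode-0 (map (1 ∷_) (H n)) (K n) (1 ∷ η)) ⟩
    c + c                              ≡⟨ cong (c +_) (+-identityʳ c) ⟨
    2 * c                              ∎
    where
    open ≡-Reasoning
    Ψ = addNode (map (1 ∷_) (H n)) (K n)
    g = λ w → countReps Ψ (w ∷ 1 ∷ η)
    c = countReps (K n) (1 ∷ η)
    g₁ : g 1 ≡ c
    g₁ = trans (countReps-addNode-1 (map (1 ∷_) (H n)) (K n) (1 ∷ η)) (trans (cong sum (sym (map-∘ (H n)))) (sym splits))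

  count-K-x0 : ∀ n x η → countReps (K (suc n)) (x ∷ 0 ∷ η) ≡ countReps (K n) (0 ∷ η)
  count-K-x0 n x η = begin
    countReps (K (suc n)) (x ∷ 0 ∷ η)  ≡⟨ countReps-simpleRoot Ψ x (0 ∷ η) ⟩
    sum≤ x g                           ≡⟨ sum≤-truncate {x} g z≤n (λ w 0<w → countReps-addNode-vanish (H n) (K n) η 0<w) ⟩
    g 0                                ≡⟨ countReps-addNode-0 (map (1 ∷_) (H n)) (K n) (0 ∷ η) ⟩
    countReps (K n) (0 ∷ η)            ∎
    where
    open ≡-Reasoning
    Ψ = addNode (map (1 ∷_) (H n)) (K n)
    g = λ w → countReps Ψ (w ∷ 0 ∷ η)

  count-K-1b1 : ∀ n w η → SplitsAt n η → countReps (K (2 + n)) (1 ∷ 2 + w ∷ 1 ∷ η) ≡ 5 * countReps (K n) (1 ∷ η)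
  count-K-1b1 n w η splits = begin
    countReps (K (2 + n)) (1 ∷ ξ)
      ≡⟨ countReps-addNode-1 (H (2 + n)) (K (suc n)) ξ ⟩
    f (zeros _) + (f (1 ∷ zeros _) + sum (map f (map (1 ∷_) (map (1 ∷_) (H n)))))
      ≡⟨ cong₂ _+_ f₀ (cong₂ _+_ f₁ f₂) ⟩
    2 * c + (2 * c + c)
      ≡⟨ five c ⟩
    5 * c ∎
    where
    open ≡-Reasoning
    ξ = 2 + w ∷ 1 ∷ η
    c = countReps (K n) (1 ∷ η)
    f = countRemainder (K (suc n)) ξ
    f₀ : f (zeros _) ≡ 2 * c
    f₀ = trans (countRemainder-zeros (K (suc n)) ξ) (count-K-x1 n η (s≤s z≤n) splits)
    f₁ : f (1 ∷ zeros _) ≡ 2 * c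
    f₁ = trans (countRemainder-simpleRoot (K (suc n)) (suc w) (1 ∷ η)) (count-K-x1 n η (s≤s z≤n) splits)
    f₂ : sum (map f (map (1 ∷_) (map (1 ∷_) (H n)))) ≡ c
    f₂ = begin
      sum (map f (map (1 ∷_) (map (1 ∷_) (H n))))  ≡⟨ cong sum (trans (sym (map-∘ _)) (sym (map-∘ (H n)))) ⟩
      sum (map (f ∘ (1 ∷_) ∘ (1 ∷_)) (H n))          ≡⟨ cong sum (map-cong (λ β → cong (λ c → if β ≤ʷ η then c else 0)
                                                          (count-K-x0 n (suc w) (minus η β))) (H n)) ⟩
      sum (map (countRemainder (K n) (1 ∷ η) ∘ (1 ∷_)) (H n)) ≡⟨ splits ⟨
      c ∎
    five : ∀ c → 2 * c + (2 * c + c) ≡ 5 * c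
    five = solve-∀

  module _ (base-count : countReps K₀ (1 ∷ 1 ∷ 1 ∷ []) ≡ 4) (base-splits : SplitsAt 0 (1 ∷ 1 ∷ [])) where

    splitsAt : ∀ n f → Admissible n f → SplitsAt n (vec (2 + n) (f ∘ suc))
    splitsAt zero    f adm = subst (SplitsAt 0) (cong₂ (λ a b → a ∷ b ∷ []) (sym end₂) (sym end₃)) base-splits
      where open Admissible adm
    splitsAt (suc n) f _   = countReps-addNode-splits (H (suc n)) (K n) _

    count-step-small : ∀ n f → Admissible (suc n) f → f 2 ≡ 1 →
                       countReps (K (suc n)) (vec (4 + n) f) ≡ 2 * countReps (K n) (vec (3 + n) (f ∘ suc))
    count-step-small n f adm f₂ = begin
      countReps (K (suc n)) (f 1 ∷ f 2 ∷ η)  ≡⟨ cong (λ y → countReps (K (suc n)) (f 1 ∷ y ∷ η)) f₂ ⟩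
      countReps (K (suc n)) (f 1 ∷ 1 ∷ η)    ≡⟨ count-K-x1 n η (positive 1) (splitsAt n (f ∘ suc) (admissible-suc adm)) ⟩
      2 * countReps (K n) (1 ∷ η)            ≡⟨ cong (λ y → 2 * countReps (K n) (y ∷ η)) f₂ ⟨
      2 * countReps (K n) (f 2 ∷ η)          ∎
      where
      open ≡-Reasoning
      open Admissible adm
      η = vec (2 + n) (f ∘ suc ∘ suc)

    count-step-big : ∀ n f w → Admissible (2 + n) f → f 2 ≡ 2 + w →
                     countReps (K (2 + n)) (vec (5 + n) f) ≡ 5 * countReps (K n) (vec (3 + n) (f ∘ suc ∘ suc))
    count-step-big n f w adm f₂ = begin
      countReps (K (2 + n)) (f 1 ∷ f 2 ∷ f 3 ∷ η)  ≡⟨ cong (countReps (K (2 + n))) shape ⟩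
      countReps (K (2 + n)) (1 ∷ 2 + w ∷ 1 ∷ η)    ≡⟨ count-K-1b1 n w η (splitsAt n (f ∘ suc ∘ suc) adm″) ⟩
      5 * countReps (K n) (1 ∷ η)                  ≡⟨ cong (λ y → 5 * countReps (K n) (y ∷ η)) f₃ ⟨
      5 * countReps (K n) (f 3 ∷ η)                ∎
      where
      open ≡-Reasoning
      η = vec (2 + n) (f ∘ suc ∘ suc ∘ suc)
      adm″ = admissible-suc (admissible-suc adm)
      big : 2 ≤ f 2
      big = subst (2 ≤_) (sym f₂) (m≤m+n 2 w)
      f₃ = small-after adm 2 big
      shape : f 1 ∷ f 2 ∷ f 3 ∷ η ≡ 1 ∷ 2 + w ∷ 1 ∷ η
      shape = cong₂ _∷_ (small-before adm 1 big) (cong₂ _∷_ f₂ (cong (_∷ η) f₃))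

    count-K : ∀ n f → Admissible n f →
              countReps (K n) (vec (3 + n) f) * 4 ^ bigCount (3 + n) f ≡ 2 ^ (2 + n) * 5 ^ bigCount (3 + n) f
    count-K zero f adm rewrite Admissible.end₁ adm | Admissible.end₂ adm | Admissible.end₃ adm =
      trans (*-identityʳ _) base-count
    count-K (suc n) f adm with small-or-big (f 2) (Admissible.positive adm 2)
    count-K (suc n) f adm | inj₁ f₂ =
      doubling {countReps (K n) (vec (3 + n) (f ∘ suc))} {2 ^ (2 + n)} (count-K n (f ∘ suc) (admissible-suc adm)) (count-step-small n f adm f₂) (bigCount-small n f f₂)
    count-K (suc zero) f adm | inj₂ (w , f₂) = case trans (sym f₂) (Admissible.end₁ adm) of λ ()
    count-K (suc (suc n)) f adm | inj₂ (w , f₂) =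
      quintupling {countReps (K n) (vec (3 + n) (f ∘ suc ∘ suc))} {2 ^ (2 + n)}
                  (count-K n (f ∘ suc ∘ suc) (admissible-suc (admissible-suc adm)))
                  (count-step-big n f w adm f₂) (bigCount-big n f w adm f₂)

-- Positive roots, one node at a time

map-map-cong : ∀ {A B C D : Set} {F : B → D} {G : C → D} {f : A → B} {g : A → C} →
               (∀ x → F (f x) ≡ G (g x)) → ∀ xs → map F (map f xs) ≡ map G (map g xs)
map-map-cong eq xs = trans (sym (map-∘ xs)) (trans (map-cong eq xs) (map-∘ xs))

map-concatMap-cong : ∀ {A B C D : Set} {F : B → D} {G : C → D} {f : A → List B} {g : A → List C} →
                     (∀ x → map F (f x) ≡ map G (g x)) → ∀ xs → map F (concatMap f xs) ≡ map G (concatMap g xs)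
map-concatMap-cong {F = F} {G} {f} {g} eq xs =
  trans (map-concatMap F f xs) (trans (concatMap-cong eq xs) (sym (map-concatMap G g xs)))

concatMap-singleton : ∀ {A B : Set} (f : A → B) xs → concatMap (λ x → f x ∷ []) xs ≡ map f xs
concatMap-singleton f xs = trans (sym (concatMap-map [_] f xs)) (concatMap-pure (map f xs))

map-map-cong-suc : ∀ {A B D : Set} {F : A → D} {G : B → D} {f : ℕ → A} {g : ℕ → B} →
                   (∀ i → F (f (suc i)) ≡ G (g (suc i))) → ∀ xs → map F (map f (map suc xs)) ≡ map G (map g (map suc xs))
map-map-cong-suc eq xs = trans (cong (map _) (sym (map-∘ xs))) (trans (map-map-cong eq xs) (cong (map _) (map-∘ xs)))

map-concatMap-cong-suc : ∀ {B C D : Set} {F : B → D} {G : C → D} {f : ℕ → List B} {g : ℕ → List C} →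
                         (∀ i → map F (f (suc i)) ≡ map G (g (suc i))) → ∀ xs →
                         map F (concatMap f (map suc xs)) ≡ map G (concatMap g (map suc xs))
map-concatMap-cong-suc {F = F} {G} {f} {g} eq xs = trans (cong (map F) (concatMap-map f suc xs))
  (trans (map-concatMap-cong eq xs) (sym (cong (map G) (concatMap-map g suc xs))))

range-suc : ∀ a b → range (suc a) (suc b) ≡ map suc (range a b)
range-suc a b = map-∘ (upTo (suc b ∸ a))

range-1-suc : ∀ b → range 1 (suc b) ≡ 1 ∷ map suc (range 1 b)
range-1-suc b = cong (1 ∷_) (cong (map suc) (sym (map-upTo suc b)))

pairs-suc : ∀ d n (g : ℕ → ℕ → List (ℕ → ℕ)) →
            concatMap (λ i → concatMap (g i) (range (d + i) (suc n))) (range 1 (suc n)) ≡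
            concatMap (g 1) (range (d + 1) (suc n)) ++ concatMap (λ i → concatMap (λ j → g (suc i) (suc j)) (range (d + i) n)) (range 1 n)
pairs-suc d n g = begin
  concatMap G (range 1 (suc n))              ≡⟨ cong (concatMap G) (range-1-suc n) ⟩
  hd ++ concatMap G (map suc (range 1 n))    ≡⟨ cong (hd ++_) (concatMap-map G suc (range 1 n)) ⟩
  hd ++ concatMap (G ∘ suc) (range 1 n)      ≡⟨ cong (hd ++_) (concatMap-cong inner (range 1 n)) ⟩
  hd ++ concatMap (λ i → concatMap (λ j → g (suc i) (suc j)) (range (d + i) n)) (range 1 n) ∎
  where
  open ≡-Reasoning
  G = λ i → concatMap (g i) (range (d + i) (suc n))
  hd = concatMap (g 1) (range (d + 1) (suc n))
  inner : ∀ i → G (suc i) ≡ concatMap (λ j → g (suc i) (suc j)) (range (d + i) n)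
  inner i = begin
    concatMap (g (suc i)) (range (d + suc i) (suc n))    ≡⟨ cong (λ a → concatMap (g (suc i)) (range a (suc n))) (+-suc d i) ⟩
    concatMap (g (suc i)) (range (suc (d + i)) (suc n))  ≡⟨ cong (concatMap (g (suc i))) (range-suc (d + i) n) ⟩
    concatMap (g (suc i)) (map suc (range (d + i) n))    ≡⟨ concatMap-map (g (suc i)) suc (range (d + i) n) ⟩
    concatMap (λ j → g (suc i) (suc j)) (range (d + i) n) ∎

-- range 1 n is map suc (upTo n) by definition, so only indices i ≥ 1 are ever used.
map-pairsLe : ∀ {D : Set} n {F G : (ℕ → ℕ) → D} {g g′ : ℕ → ℕ → List (ℕ → ℕ)} →
              (∀ i j → map F (g (suc i) j) ≡ map G (g′ (suc i) j)) → map F (pairsLe n g) ≡ map G (pairsLe n g′)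
map-pairsLe n eq = map-concatMap-cong-suc (λ i → map-concatMap-cong (eq i) (range (suc i) n)) (upTo n)

map-pairsLt : ∀ {D : Set} n {F G : (ℕ → ℕ) → D} {g g′ : ℕ → ℕ → List (ℕ → ℕ)} →
              (∀ i j → map F (g (suc i) (suc j)) ≡ map G (g′ (suc i) (suc j))) → map F (pairsLt n g) ≡ map G (pairsLt n g′)
map-pairsLt n {F} {G} {g} {g′} eq = map-concatMap-cong-suc inner (upTo n)
  where
  inner : ∀ i → map F (concatMap (g (suc i)) (range (suc (suc i)) n)) ≡ map G (concatMap (g′ (suc i)) (range (suc (suc i)) n))
  inner i = trans (cong (map F ∘ concatMap (g (suc i))) (map-∘ U))
    (trans (map-concatMap-cong-suc (eq i) (map (suc i +_) U)) (cong (map G ∘ concatMap (g′ (suc i))) (sym (map-∘ U))))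
    where U = upTo (n ∸ suc i)

range-split : ∀ {r} n a (ψ′ ψ : ℕ → ℕ → ℕ) → (∀ i → vec (suc r) (ψ′ (2 + i)) ≡ a ∷ vec r (ψ (1 + i))) →
              map (vec (suc r)) (map ψ′ (range 1 (suc n))) ≡ vec (suc r) (ψ′ 1) ∷ map (a ∷_) (map (vec r) (map ψ (range 1 n)))
range-split {r} n a ψ′ ψ shift = trans (cong (map (vec (suc r)) ∘ map ψ′) (range-1-suc n))
  (cong (vec (suc r) (ψ′ 1) ∷_) (trans (cong (map (vec (suc r))) (sym (map-∘ (range 1 n))))
    (trans (map-map-cong-suc shift (upTo n)) (map-∘ (map ψ (range 1 n))))))

range-2-split : ∀ {r} n a (ψ′ ψ : ℕ → ℕ → ℕ) → (∀ j → vec (suc r) (ψ′ (3 + j)) ≡ a ∷ vec r (ψ (2 + j))) →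
                map (vec (suc r)) (map ψ′ (range 2 (2 + n))) ≡ vec (suc r) (ψ′ 2) ∷ map (a ∷_) (map (vec r) (map ψ (range 2 (1 + n))))
range-2-split {r} n a ψ′ ψ shift = begin
  map (vec (suc r)) (map ψ′ (range 2 (2 + n)))
    ≡⟨ cong (map (vec (suc r))) (shift-range ψ′ (1 + n)) ⟩
  map (vec (suc r)) (map (ψ′ ∘ suc) (range 1 (1 + n)))
    ≡⟨ range-split n a (ψ′ ∘ suc) (ψ ∘ suc) shift ⟩
  vec (suc r) (ψ′ 2) ∷ map (a ∷_) (map (vec r) (map (ψ ∘ suc) (range 1 n)))
    ≡⟨ cong (λ xs → vec (suc r) (ψ′ 2) ∷ map (a ∷_) (map (vec r) xs)) (shift-range ψ n) ⟨
  vec (suc r) (ψ′ 2) ∷ map (a ∷_) (map (vec r) (map ψ (range 2 (1 + n)))) ∎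
  where
  open ≡-Reasoning
  shift-range : ∀ (h : ℕ → ℕ → ℕ) b → map h (range 2 (suc b)) ≡ map (h ∘ suc) (range 1 b)
  shift-range h b = trans (cong (map h) (range-suc 1 b)) (sym (map-∘ (range 1 b)))

record SplitsAs (r : ℕ) (P′ Q P : List (ℕ → ℕ)) : Set where
  constructor splitsAs
  field split : map (vec (suc r)) P′ ↭ map (vec (suc r)) Q ++ map (0 ∷_) (map (vec r) P)

splitsAs-++ : ∀ {r P′ Q P R′ S R} → SplitsAs r P′ Q P → SplitsAs r R′ S R → SplitsAs r (P′ ++ R′) (Q ++ S) (P ++ R)
splitsAs-++ {r} {P′} {Q} {P} {R′} {S} {R} (splitsAs p) (splitsAs r′) = splitsAs (begin
  map V′ (P′ ++ R′)                        ≡⟨ map-++ V′ P′ R′ ⟩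
  map V′ P′ ++ map V′ R′                   ↭⟨ ++⁺ p r′ ⟩
  (map V′ Q ++ X) ++ (map V′ S ++ Y)       ↭⟨ interchange (map V′ Q) X (map V′ S) Y ⟩
  (map V′ Q ++ map V′ S) ++ (X ++ Y)       ≡⟨ cong₂ _++_ (map-++ V′ Q S) (trans (cong (map (0 ∷_)) (map-++ V P R)) (map-++ (0 ∷_) (map V P) (map V R))) ⟨
  map V′ (Q ++ S) ++ map (0 ∷_) (map V (P ++ R)) ∎)
  where
  open PermutationReasoning
  open CommSemigroupProperties (CommutativeMonoid.commutativeSemigroup (++-commutativeMonoid {A = Weight (suc r)}))
    using (interchange)
  V′ = vec (suc r)
  V  = vec r
  X  = map (0 ∷_) (map V P)
  Y  = map (0 ∷_) (map V R)

intervals-split : ∀ {r} n → SplitsAs r (pairsLe (suc n) (λ i j → seg i j ∷ [])) (map (seg 1) (range 1 (suc n)))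
                                       (pairsLe n (λ i j → seg i j ∷ []))
intervals-split {r} n = splitsAs (↭-reflexive (begin
  map V′ (pairsLe (suc n) g)
    ≡⟨ cong (map V′) (pairs-suc 0 n g) ⟩
  map V′ (concatMap (g 1) (range 1 (suc n)) ++ pairsLe n (λ i j → g (suc i) (suc j)))
    ≡⟨ map-++ V′ (concatMap (g 1) (range 1 (suc n))) _ ⟩
  map V′ (concatMap (g 1) (range 1 (suc n))) ++ map V′ (pairsLe n (λ i j → g (suc i) (suc j)))
    ≡⟨ cong₂ _++_ (cong (map V′) (concatMap-singleton (seg 1) (range 1 (suc n)))) (trans (map-pairsLe n shift) (map-∘ (pairsLe n g))) ⟩
  map V′ (map (seg 1) (range 1 (suc n))) ++ map (0 ∷_) (map (vec r) (pairsLe n g)) ∎))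
  where
  open ≡-Reasoning
  V′ = vec (suc r)
  g = λ i j → seg i j ∷ []
  shift : ∀ i j → V′ (seg (2 + i) (1 + j)) ∷ [] ≡ (0 ∷ vec r (seg (1 + i) j)) ∷ []
  shift i j = cong [_] (vec-∷ r (seg (2 + i) (1 + j)) (seg (1 + i) j) 0 refl (λ m → seg-suc (1 + i) j (1 + m)))

pairsLt-split : ∀ {r} n (φ′ φ : ℕ → ℕ → ℕ → ℕ) →
                (∀ i j → φ′ (2 + i) (2 + j) 1 ≡ 0) → (∀ i j m → φ′ (2 + i) (2 + j) (2 + m) ≡ φ (1 + i) (1 + j) (1 + m)) →
                SplitsAs r (pairsLt (suc n) (λ i j → φ′ i j ∷ [])) (map (φ′ 1) (range 2 (suc n))) (pairsLt n (λ i j → φ i j ∷ []))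
pairsLt-split {r} n φ′ φ first shift = splitsAs (↭-reflexive (begin
  map V′ (pairsLt (suc n) g′)
    ≡⟨ cong (map V′) (pairs-suc 1 n g′) ⟩
  map V′ (concatMap (g′ 1) (range 2 (suc n)) ++ pairsLt n (λ i j → g′ (suc i) (suc j)))
    ≡⟨ map-++ V′ (concatMap (g′ 1) (range 2 (suc n))) _ ⟩
  map V′ (concatMap (g′ 1) (range 2 (suc n))) ++ map V′ (pairsLt n (λ i j → g′ (suc i) (suc j)))
    ≡⟨ cong₂ _++_ (cong (map V′) (concatMap-singleton (φ′ 1) (range 2 (suc n))))
                  (trans (map-pairsLt n (λ i j → cong [_] (shift′ i j))) (map-∘ (pairsLt n g))) ⟩
  map V′ (map (φ′ 1) (range 2 (suc n))) ++ map (0 ∷_) (map (vec r) (pairsLt n g)) ∎))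
  where
  open ≡-Reasoning
  V′ = vec (suc r)
  g′ = λ i j → φ′ i j ∷ []
  g  = λ i j → φ i j ∷ []
  shift′ : ∀ i j → V′ (φ′ (2 + i) (2 + j)) ≡ 0 ∷ vec r (φ (1 + i) (1 + j))
  shift′ i j = vec-∷ r (φ′ (2 + i) (2 + j)) (φ (1 + i) (1 + j)) 0 (first i j) (shift i j)

range-splitsAs : ∀ {r} n (ψ′ ψ : ℕ → ℕ → ℕ) → (∀ i → ψ′ (2 + i) 1 ≡ 0) → (∀ i m → ψ′ (2 + i) (2 + m) ≡ ψ (1 + i) (1 + m)) →
                 SplitsAs r (map ψ′ (range 1 (suc n))) (ψ′ 1 ∷ []) (map ψ (range 1 n))
range-splitsAs {r} n ψ′ ψ first shift =
  splitsAs (↭-reflexive (range-split n 0 ψ′ ψ (λ i → vec-∷ r (ψ′ (2 + i)) (ψ (1 + i)) 0 (first i) (shift i))))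

-- The root families of posRootsFn: φX r i j is eᵢ + eⱼ in type X, ψC r i is 2eᵢ and ψD r i is eᵢ + eᵣ.
φB φC φD : ℕ → ℕ → ℕ → ℕ → ℕ
φB r i j m = seg i (j ∸ 1) m + 2 * seg j r m
φC r i j m = seg i (j ∸ 1) m + 2 * seg j (r ∸ 1) m + seg r r m
φD r i j m = seg i (j ∸ 1) m + 2 * seg j (r ∸ 2) m + seg (r ∸ 1) (r ∸ 1) m + seg r r m

ψC ψD : ℕ → ℕ → ℕ → ℕ
ψC r i m = 2 * seg i (r ∸ 1) m + seg r r m
ψD r i m = seg i (r ∸ 2) m + seg r r m

φB-suc : ∀ n i j m → φB (4 + n) (suc i) (2 + j) (2 + m) ≡ φB (3 + n) i (1 + j) (1 + m)
φB-suc n i j m = cong₂ _+_ (seg-suc i j (1 + m)) (cong (2 *_) (seg-suc (1 + j) (3 + n) (1 + m)))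

φC-suc : ∀ n i j m → φC (4 + n) (suc i) (2 + j) (2 + m) ≡ φC (3 + n) i (1 + j) (1 + m)
φC-suc n i j m = cong₂ _+_ (cong₂ _+_ (seg-suc i j (1 + m)) (cong (2 *_) (seg-suc (1 + j) (2 + n) (1 + m))))
                           (seg-suc (3 + n) (3 + n) (1 + m))

φD-suc : ∀ n i j m → φD (4 + n) (suc i) (2 + j) (2 + m) ≡ φD (3 + n) i (1 + j) (1 + m)
φD-suc n i j m = cong₂ _+_ (cong₂ _+_ (cong₂ _+_ (seg-suc i j (1 + m)) (cong (2 *_) (seg-suc (1 + j) (1 + n) (1 + m))))
                                      (seg-suc (2 + n) (2 + n) (1 + m)))
                           (seg-suc (3 + n) (3 + n) (1 + m))

ψC-suc : ∀ n i m → ψC (4 + n) (suc i) (2 + m) ≡ ψC (3 + n) i (1 + m)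
ψC-suc n i m = cong₂ _+_ (cong (2 *_) (seg-suc i (2 + n) (1 + m))) (seg-suc (3 + n) (3 + n) (1 + m))

ψD-suc : ∀ n i m → ψD (4 + n) (suc i) (2 + m) ≡ ψD (3 + n) i (1 + m)
ψD-suc n i m = cong₂ _+_ (seg-suc i (1 + n) (1 + m)) (seg-suc (3 + n) (3 + n) (1 + m))

headsFn : ClassicalType → ℕ → List (ℕ → ℕ)
headsFn A r = map (seg 1) (range 1 r)
headsFn B r = map (seg 1) (range 1 r) ++ map (φB r 1) (range 2 r)
headsFn C r = map (seg 1) (range 1 (r ∸ 1)) ++ map (φC r 1) (range 2 r) ++ ψC r 1 ∷ []
headsFn D r = map (seg 1) (range 1 (r ∸ 1)) ++ ψD r 1 ∷ [] ++ map (φD r 1) (range 2 (r ∸ 1))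

posRoots-split : ∀ t n → SplitsAs (3 + n) (posRootsFn t (4 + n)) (headsFn t (4 + n)) (posRootsFn t (3 + n))
posRoots-split A n = intervals-split (3 + n)
posRoots-split B n = splitsAs-++ (intervals-split (3 + n))
                                 (pairsLt-split (3 + n) (φB (4 + n)) (φB (3 + n)) (λ _ _ → refl) (φB-suc n ∘ suc))
posRoots-split C n = splitsAs-++ (intervals-split (2 + n))
                       (splitsAs-++ (pairsLt-split (3 + n) (φC (4 + n)) (φC (3 + n)) (λ _ _ → refl) (φC-suc n ∘ suc))
                                    (range-splitsAs (3 + n) (ψC (4 + n)) (ψC (3 + n)) (λ _ → refl) (ψC-suc n ∘ suc)))
posRoots-split D n = splitsAs-++ (intervals-split (2 + n))
                       (splitsAs-++ (range-splitsAs (2 + n) (ψD (4 + n)) (ψD (3 + n)) (λ _ → refl) (ψD-suc n ∘ suc))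
                                    (pairsLt-split (2 + n) (φD (4 + n)) (φD (3 + n)) (λ _ _ → refl) (φD-suc n ∘ suc)))

record FilterStep (n : ℕ) (zs : List (Weight (4 + n))) (H′ H : List (ℕ → ℕ)) : Set where
  constructor filterStep
  field filtered : filterᵇ last3≤1 (map (vec (4 + n)) H′) ≡ zs ++ map (1 ∷_) (filterᵇ last3≤1 (map (vec (3 + n)) H))

filterStep-++ : ∀ {n zs I′ O′ I O} → FilterStep n zs I′ I → FilterStep n [] O′ O → FilterStep n zs (I′ ++ O′) (I ++ O)
filterStep-++ {n} {zs} {I′} {O′} {I} {O} (filterStep eqI) (filterStep eqO) = filterStep (begin
  F′ (I′ ++ O′)                                  ≡⟨ filter-last3≤1-map-++ (vec (4 + n)) I′ O′ ⟩
  F′ I′ ++ F′ O′                                 ≡⟨ cong₂ _++_ eqI eqO ⟩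
  (zs ++ map (1 ∷_) (F I)) ++ map (1 ∷_) (F O)   ≡⟨ ++-assoc zs _ _ ⟩
  zs ++ (map (1 ∷_) (F I) ++ map (1 ∷_) (F O))   ≡⟨ cong (zs ++_) (map-++ (1 ∷_) (F I) (F O)) ⟨
  zs ++ map (1 ∷_) (F I ++ F O)                  ≡⟨ cong (λ xs → zs ++ map (1 ∷_) xs) (filter-last3≤1-map-++ (vec (3 + n)) I O) ⟨
  zs ++ map (1 ∷_) (F (I ++ O))                  ∎)
  where
  open ≡-Reasoning
  F′ = λ X → filterᵇ last3≤1 (map (vec (4 + n)) X)
  F  = λ X → filterᵇ last3≤1 (map (vec (3 + n)) X)

intervals-filterStep : ∀ n b → FilterStep n ((1 ∷ zeros (3 + n)) ∷ []) (map (seg 1) (range 1 (suc b))) (map (seg 1) (range 1 b))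
intervals-filterStep n b = filterStep (begin
  filterᵇ last3≤1 (map (vec (4 + n)) (map (seg 1) (range 1 (suc b))))
    ≡⟨ cong (filterᵇ last3≤1) (range-split b 1 (seg 1) (seg 1) shift) ⟩
  filterᵇ last3≤1 ((1 ∷ zeros (3 + n)) ∷ map (1 ∷_) ys)
    ≡⟨ filter-accept (T? ∘ last3≤1) (last3≤1-zeros n) ⟩
  (1 ∷ zeros (3 + n)) ∷ filterᵇ last3≤1 (map (1 ∷_) ys)
    ≡⟨ cong ((1 ∷ zeros (3 + n)) ∷_) (filter-last3≤1-∷ 1 ys) ⟩
  (1 ∷ zeros (3 + n)) ∷ map (1 ∷_) (filterᵇ last3≤1 ys) ∎)
  where
  open ≡-Reasoning
  ys = map (vec (3 + n)) (map (seg 1) (range 1 b))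
  shift : ∀ j → vec (4 + n) (seg 1 (2 + j)) ≡ 1 ∷ vec (3 + n) (seg 1 (1 + j))
  shift j = vec-∷ (3 + n) (seg 1 (2 + j)) (seg 1 (1 + j)) 1 refl (λ m → seg-suc 0 (1 + j) (1 + m))

φHeads-filterStep : ∀ n b (φ′ φ : ℕ → ℕ → ℕ) → (∀ j → φ′ (3 + j) 1 ≡ 1) → (∀ j m → φ′ (3 + j) (2 + m) ≡ φ (2 + j) (1 + m)) →
                    ¬ T (last3≤1 (vec (4 + n) (φ′ 2))) → FilterStep n [] (map φ′ (range 2 (2 + b))) (map φ (range 2 (1 + b)))
φHeads-filterStep n b φ′ φ first shift dead = filterStep (trans (cong (filterᵇ last3≤1) (range-2-split b 1 φ′ φ shift′))
  (trans (filter-reject (T? ∘ last3≤1) {vec (4 + n) (φ′ 2)} {map (1 ∷_) ys} dead) (filter-last3≤1-∷ 1 ys)))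
  where
  ys = map (vec (3 + n)) (map φ (range 2 (1 + b)))
  shift′ : ∀ j → vec (4 + n) (φ′ (3 + j)) ≡ 1 ∷ vec (3 + n) (φ (2 + j))
  shift′ j = vec-∷ (3 + n) (φ′ (3 + j)) (φ (2 + j)) 1 (first j) (shift j)

two≤ : ∀ {s} x → s ≡ 1 → 2 ≤ 2 * s + x
two≤ x refl = m≤m+n 2 x

-- Each of these roots has coefficient 2 at α_{r-2}.
φB-dead : ∀ n → ¬ T (last3≤1 (vec (4 + n) (φB (4 + n) 1 2)))
φB-dead n = subst T (last3≤1-vec-big (1 + n) (φB (4 + n) 1 2)
  (≤-reflexive (cong (2 *_) (sym (seg-inside (m≤m+n 2 n) (m≤n+m (2 + n) 2))))))

φC-dead : ∀ n → ¬ T (last3≤1 (vec (4 + n) (φC (4 + n) 1 2)))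
φC-dead n = subst T (last3≤1-vec-big (1 + n) (φC (4 + n) 1 2) (two≤ _ (seg-inside (m≤m+n 2 n) (n≤1+n (2 + n)))))

φD-dead : ∀ n → ¬ T (last3≤1 (vec (4 + n) (φD (4 + n) 1 2)))
φD-dead n = subst T (last3≤1-vec-big (1 + n) (φD (4 + n) 1 2)
  (≤-trans (two≤ _ (seg-inside (m≤m+n 2 n) ≤-refl)) (m≤m+n _ _)))

ψC-dead : ∀ k → ¬ T (last3≤1 (vec (3 + k) (ψC (3 + k) 1)))
ψC-dead k = subst T (last3≤1-vec-big k (ψC (3 + k) 1) (two≤ _ (seg-inside (s≤s z≤n) (n≤1+n (1 + k)))))

heads-filterStep : ∀ t n → FilterStep n ((1 ∷ zeros (3 + n)) ∷ []) (headsFn t (4 + n)) (headsFn t (3 + n))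
heads-filterStep A n = intervals-filterStep n (3 + n)
heads-filterStep B n = filterStep-++ (intervals-filterStep n (3 + n))
  (φHeads-filterStep n (2 + n) (φB (4 + n) 1) (φB (3 + n) 1) (λ _ → refl) (λ j → φB-suc n 0 (1 + j)) (φB-dead n))
heads-filterStep C n = filterStep-++ (intervals-filterStep n (2 + n)) (filterStep-++
  (φHeads-filterStep n (2 + n) (φC (4 + n) 1) (φC (3 + n) 1) (λ _ → refl) (λ j → φC-suc n 0 (1 + j)) (φC-dead n))
  (filterStep (trans (filter-reject (T? ∘ last3≤1) {vec (4 + n) (ψC (4 + n) 1)} {[]} (ψC-dead (1 + n)))
                     (cong (map (1 ∷_)) (sym (filter-reject (T? ∘ last3≤1) {vec (3 + n) (ψC (3 + n) 1)} {[]} (ψC-dead n)))))))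
heads-filterStep D n = filterStep-++ (intervals-filterStep n (2 + n)) (filterStep-++
  (filterStep (trans (cong (λ v → filterᵇ last3≤1 (v ∷ [])) (vec-∷ (3 + n) (ψD (4 + n) 1) (ψD (3 + n) 1) 1 refl (ψD-suc n 0)))
                     (filter-last3≤1-∷ 1 (vec (3 + n) (ψD (3 + n) 1) ∷ []))))
  (φHeads-filterStep n (1 + n) (φD (4 + n) 1) (φD (3 + n) 1) (λ _ → refl) (λ j → φD-suc n 0 (1 + j)) (φD-dead n)))

H₀ : ClassicalType → List (Weight 2)
H₀ t = map Vec.tail (filterᵇ last3≤1 (map (vec 3) (headsFn t 3)))

K₀ : ClassicalType → List (Weight 3)
K₀ t = filterᵇ last3≤1 (posRoots t 3)

heads-base : ∀ t → filterᵇ last3≤1 (map (vec 3) (headsFn t 3)) ≡ map (1 ∷_) (H₀ t)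
heads-base A = refl
heads-base B = refl
heads-base C = refl
heads-base D = refl

nonzero-by-decision : ∀ {r} (Φ : List (Weight r)) → True (all? (λ α → 1 ≤? height α) Φ) → All (NonZero ∘ height) Φ
nonzero-by-decision Φ ok = All.map >-nonZero (toWitness ok)

nonzero-K₀ : ∀ t → All (NonZero ∘ height) (K₀ t)
nonzero-K₀ A = nonzero-by-decision (K₀ A) _
nonzero-K₀ B = nonzero-by-decision (K₀ B) _
nonzero-K₀ C = nonzero-by-decision (K₀ C) _
nonzero-K₀ D = nonzero-by-decision (K₀ D) _

base-count : ∀ t → countReps (K₀ t) (1 ∷ 1 ∷ 1 ∷ []) ≡ 4
base-count A = refl
base-count B = refl
base-count C = refl
base-count D = refl

base-splits : ∀ t → Extension.SplitsAt (H₀ t) (K₀ t) 0 (1 ∷ 1 ∷ [])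
base-splits A = refl
base-splits B = refl
base-splits C = refl
base-splits D = refl

module FilteredRoots (t : ClassicalType) where
  open Extension (H₀ t) (K₀ t) public

  filtered-heads : ∀ n → filterᵇ last3≤1 (map (vec (3 + n)) (headsFn t (3 + n))) ≡ map (1 ∷_) (H n)
  filtered-heads zero    = heads-base t
  filtered-heads (suc n) = trans (FilterStep.filtered (heads-filterStep t n))
                                 (cong (λ xs → (1 ∷ zeros (3 + n)) ∷ map (1 ∷_) xs) (filtered-heads n))

  filtered-K : ∀ n → filterᵇ last3≤1 (posRoots t (3 + n)) ↭ K n
  filtered-K zero    = ↭-refl
  filtered-K (suc n) = begin
    filterᵇ last3≤1 (posRoots t (4 + n))
      ↭⟨ filter-↭ (T? ∘ last3≤1) (SplitsAs.split (posRoots-split t n)) ⟩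
    filterᵇ last3≤1 (map (vec (4 + n)) (headsFn t (4 + n)) ++ map (0 ∷_) (posRoots t (3 + n)))
      ≡⟨ filter-++ (T? ∘ last3≤1) (map (vec (4 + n)) (headsFn t (4 + n))) _ ⟩
    filterᵇ last3≤1 (map (vec (4 + n)) (headsFn t (4 + n))) ++ filterᵇ last3≤1 (map (0 ∷_) (posRoots t (3 + n)))
      ≡⟨ cong₂ _++_ (filtered-heads (suc n)) (filter-last3≤1-∷ 0 (posRoots t (3 + n))) ⟩
    map (1 ∷_) (H (suc n)) ++ map (0 ∷_) (filterᵇ last3≤1 (posRoots t (3 + n)))
      ↭⟨ ++⁺ˡ (map (1 ∷_) (H (suc n))) (map⁺ (0 ∷_) (filtered-K n)) ⟩
    K (suc n) ∎
    where open PermutationReasoning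

  nonzero-K : ∀ n → All (NonZero ∘ height) (K n)
  nonzero-K zero    = nonzero-K₀ t
  nonzero-K (suc n) = Allₚ.++⁺ (Allₚ.map⁺ (All.universal (λ _ → _) (H (suc n)))) (Allₚ.map⁺ (nonzero-K n))

  kostant-K : ∀ n ξ → T (last3≤1 ξ) → kostant t (3 + n) ξ ≡ countReps (K n) ξ
  kostant-K n ξ small = trans (countReps-last3≤1 (posRoots t (3 + n)) ξ small)
    (countReps-↭ (All-resp-↭ (↭-sym (filtered-K n)) (nonzero-K n)) (filtered-K n) ξ)

-- The weight λ

-- lambdaWeight r ℓ i c unfolds to vec r (lambdaCoeff ℓ i c).
lambdaCoeff : (ℓ : ℕ) → (Fin ℓ → ℕ) → (Fin ℓ → ℕ) → ℕ → ℕ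
lambdaCoeff ℓ i c m = 1 + sum (map (λ j → if i j ≡ᵇ m then c j else 0) (allFin ℓ))

lambdaCoeff-miss : ∀ {ℓ} (i c : Fin ℓ → ℕ) m → (∀ j → i j ≢ m) → lambdaCoeff ℓ i c m ≡ 1
lambdaCoeff-miss {ℓ} i c m miss = cong suc (sum-map-zero _ (allFin ℓ) (λ j → if-≡ᵇ-miss (c j) (miss j)))

lambdaCoeff-hit : ∀ {ℓ} (i c : Fin ℓ → ℕ) m → 2 ≤ lambdaCoeff ℓ i c m → ∃[ j ] i j ≡ m
lambdaCoeff-hit {ℓ} i c m (s≤s pos) with sum-map-positive _ (allFin ℓ) pos
... | j , cj with i j ≡ᵇ m in eq | cj
...   | true  | _ = j , ≡ᵇ⇒≡ (i j) m (from T-≡ eq)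
...   | false | ()

lambdaCoeff-suc : ∀ ℓ (i c : Fin (suc ℓ) → ℕ) m →
                  lambdaCoeff (suc ℓ) i c m ≡ lambdaCoeff ℓ (i ∘ Fin.suc) (c ∘ Fin.suc) m + (if i Fin.zero ≡ᵇ m then c Fin.zero else 0)
lambdaCoeff-suc ℓ i c m = cong suc (trans (cong (F Fin.zero +_) tail-sum) (+-comm (F Fin.zero) _))
  where
  F = λ j → if i j ≡ᵇ m then c j else 0
  tail-sum : sum (map F (tabulate Fin.suc)) ≡ sum (map (F ∘ Fin.suc) (allFin ℓ))
  tail-sum = cong sum (trans (map-tabulate Fin.suc F) (sym (map-tabulate id (F ∘ Fin.suc))))

module _ {ℓ} (i c : Fin ℓ → ℕ) (increasing : ∀ j k → toℕ j < toℕ k → i j + 1 < i k) where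

  no-adjacent-hits : ∀ {j k m} → i j ≡ m → i k ≡ suc m → ⊥
  no-adjacent-hits {j} {k} {m} ij ik with <-cmp (toℕ j) (toℕ k)
  ... | tri< j<k _ _ = <-irrefl (+-comm m 1) (subst₂ (λ a b → a + 1 < b) ij ik (increasing j k j<k))
  ... | tri≈ _ j≡k _ = 1+n≢n (sym (trans (sym ij) (trans (cong i (toℕ-injective j≡k)) ik)))
  ... | tri> _ _ k<j = <⇒≱ (subst₂ (λ a b → a + 1 < b) ik ij (increasing k j k<j)) (≤-trans (n≤1+n m) (m≤m+n (suc m) 1))

  lambda-admissible : ∀ n → (∀ j → i j < 1 + n) → Admissible n (lambdaCoeff ℓ i c)
  lambda-admissible n below = record
    { positive = λ _ → s≤s z≤n
    ; sparse   = λ m big big′ → no-adjacent-hits (proj₂ (lambdaCoeff-hit i c m big)) (proj₂ (lambdaCoeff-hit i c (suc m) big′))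
    ; end₁     = beyond ≤-refl
    ; end₂     = beyond (n≤1+n _)
    ; end₃     = beyond (≤-trans (n≤1+n _) (n≤1+n _))
    }
    where
    beyond : ∀ {m} → 1 + n ≤ m → lambdaCoeff ℓ i c m ≡ 1
    beyond n<m = lambdaCoeff-miss i c _ (λ j ij≡m → <⇒≱ (below j) (subst (1 + n ≤_) (sym ij≡m) n<m))

bigCount-lambda : ∀ R ℓ (i c : Fin ℓ → ℕ) → (∀ j → 2 ≤ i j) → (∀ j → i j ≤ R) →
                  (∀ j k → toℕ j < toℕ k → i j + 1 < i k) → (∀ j → 1 ≤ c j) → bigCount R (lambdaCoeff ℓ i c) ≡ ℓ
bigCount-lambda R zero    i c _  _  _   _   = bigCount-ones R
bigCount-lambda R (suc ℓ) i c lo hi inc pos = begin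
  bigCount R (lambdaCoeff (suc ℓ) i c)
    ≡⟨ bigCount-cong R (λ m _ → lambdaCoeff-suc ℓ i c m) ⟩
  bigCount R (λ m → lambdaCoeff ℓ (i ∘ Fin.suc) (c ∘ Fin.suc) m + (if i Fin.zero ≡ᵇ m then c Fin.zero else 0))
    ≡⟨ bigCount-bump R _ (lo Fin.zero) (hi Fin.zero) (lambdaCoeff-miss (i ∘ Fin.suc) (c ∘ Fin.suc) _ fresh) (pos Fin.zero) ⟩
  suc (bigCount R (lambdaCoeff ℓ (i ∘ Fin.suc) (c ∘ Fin.suc)))
    ≡⟨ cong suc (bigCount-lambda R ℓ (i ∘ Fin.suc) (c ∘ Fin.suc) (lo ∘ Fin.suc) (hi ∘ Fin.suc)
                   (λ j k j<k → inc (Fin.suc j) (Fin.suc k) (s≤s j<k)) (pos ∘ Fin.suc)) ⟩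
  suc ℓ ∎
  where
  open ≡-Reasoning
  fresh : ∀ j → i (Fin.suc j) ≢ i Fin.zero
  fresh j eq = <⇒≱ (subst (i Fin.zero + 1 <_) eq (inc Fin.zero (Fin.suc j) (s≤s z≤n))) (m≤m+n (i Fin.zero) 1)

corollary3p4 : (t : ClassicalType) (r : ℕ) → 5 ≤ r →
    (ℓ : ℕ) (i : Fin ℓ → ℕ) (c : Fin ℓ → ℕ) →
    (∀ j → 1 < i j × i j < r ∸ 2) →
    (∀ j k → toℕ j < toℕ k → i j + 1 < i k) →
    (∀ j → 1 ≤ c j) →
    kostant t r (lambdaWeight r ℓ i c) * 4 ^ ℓ ≡ 2 ^ (r ∸ 1) * 5 ^ ℓ
corollary3p4 t _ (s≤s (s≤s (s≤s {n = n} _))) ℓ i c bounds increasing positive =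
  subst (λ s → kostant t (3 + n) (vec (3 + n) f) * 4 ^ s ≡ 2 ^ (2 + n) * 5 ^ s) big≡ℓ (begin
    kostant t (3 + n) (vec (3 + n) f) * 4 ^ bigCount (3 + n) f
      ≡⟨ cong (_* 4 ^ bigCount (3 + n) f) (kostant-K n (vec (3 + n) f) (admissible-last3≤1 adm)) ⟩
    countReps (K n) (vec (3 + n) f) * 4 ^ bigCount (3 + n) f
      ≡⟨ count-K (base-count t) (base-splits t) n f adm ⟩
    2 ^ (2 + n) * 5 ^ bigCount (3 + n) f ∎)
  where
  open ≡-Reasoning
  open FilteredRoots t
  f = lambdaCoeff ℓ i c
  adm = lambda-admissible i c increasing n (proj₂ ∘ bounds)
  big≡ℓ = bigCount-lambda (3 + n) ℓ i c (proj₁ ∘ bounds) (λ j → ≤-trans (<⇒≤ (proj₂ (bounds j))) (m≤n+m (1 + n) 2))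
                          increasing positive
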